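{- Let $S\subseteq[n]$ be nonempty with $k=|S|$, let $T_S$ be a tableau of shape $\lambda^k=(k,1^{n-k})$ containing each of $1,\dots,n$ once and whose first row consists of the elements of $S$, and let $c_S=c_{T_S}$. Let $e\in[n]\setminus S$, and for $f\in S$ let $c_{S\cup e-f}$ denote the Young symmetrizer of the tableau obtained from $T_S$ by interchanging the entries $e$ and $f$. Then in $\mathbb{C}\mathfrak{S}_n$, $$c_S=\sum_{f\in S}c_{S\cup e-f}\,(ef),$$ where $(ef)$ is the transposition of $e$ and $f$.
   Context: For a tableau $T$ of shape $\lambda$ containing each of $1,\dots,n$ exactly once, its Young symmetrizer is $c_T=\big(\sum_{\sigma\in R_T}\mathrm{sign}(\sigma)\sigma\big)\big(\sum_{\tau\in C_T}\tau\big)\in\mathbb{C}\mathfrak{S}_n$, where $R_T$ (resp. $C_T$) is the subgroup of $\mathfrak{S}_n$ preserving each row (resp. each column) of $T$. -}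

module Defs where

open import Data.Nat using (ℕ; zero; suc; _<_; _∸_)
open import Data.Integer as ℤ using (ℤ)
open import Data.Fin using (Fin; _≟_)
open import Data.Fin.Properties using (all?; any?)
open import Data.Fin.Subset using (Subset; _∈_)
open import Data.Fin.Subset.Properties using (_∈?_)
open import Data.List using (List; []; _∷_; [_]; map; concatMap; filter; _++_; replicate; length)
open import Data.Nat.ListAction using (sum)
open import Data.List as L using (allFin)
open import Data.Vec using (Vec; []; _∷_; lookup)
open import Data.Product using (_×_; _,_; proj₁; proj₂)
open import Data.Empty using (⊥)
open import Data.Bool using (if_then_else_)
open import Relation.Nullary using (Dec; yes; no; ¬_)
open import Relation.Nullary.Decidable using (⌊_⌋; _×-dec_; _→-dec_)
open import Relation.Binary.PropositionalEquality using (_≡_)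
import Data.Nat as ℕ

-- Permutations of [n] = Fin n, represented as functions Fin n → Fin n
-- (only bijective ones are ever enumerated below).
Perm : ℕ → Set
Perm n = Fin n → Fin n

allVecs : (n m : ℕ) → List (Vec (Fin n) m)
allVecs n zero = [ [] ]
allVecs n (suc m) = concatMap (λ i → map (i ∷_) (allVecs n m)) (allFin n)

allFuns : (n : ℕ) → List (Perm n)
allFuns n = map lookup (allVecs n n)

IsPerm : ∀ {n} → Perm n → Set
IsPerm σ = ∀ i j → σ i ≡ σ j → i ≡ j

isPerm? : ∀ {n} (σ : Perm n) → Dec (IsPerm σ)
isPerm? σ = all? λ i → all? λ j → (σ i ≟ σ j) →-dec (i ≟ j)

allPerms : (n : ℕ) → List (Perm n)
allPerms n = filter isPerm? (allFuns n)

inversions : ∀ {n} → Perm n → ℕ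
inversions {n} σ =
  length (filter (λ p → (proj₁ p Data.Fin.<? proj₂ p) ×-dec (σ (proj₂ p) Data.Fin.<? σ (proj₁ p)))
                 (concatMap (λ i → map (λ j → i , j) (allFin n)) (allFin n)))

sign : ∀ {n} → Perm n → ℤ
sign σ = (ℤ.- ℤ.1ℤ) ℤ.^ inversions σ

transposition : ∀ {n} → Fin n → Fin n → Perm n
transposition e f i with i ≟ e | i ≟ f
... | yes _ | _     = f
... | no _  | yes _ = e
... | no _  | no _  = i

-- Group algebra ℤ𝔖_n: formal finite sums  Σ c_σ σ  (lists of terms),
-- compared by their coefficient functions.

GA : ℕ → Set
GA n = List (ℤ × Perm n)

coeff : ∀ {n} → GA n → Perm n → ℤ
coeff [] g = ℤ.0ℤ
coeff ((c , σ) ∷ x) g with all? (λ i → σ i ≟ g i)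
... | yes _ = c ℤ.+ coeff x g
... | no _  = coeff x g

infix 4 _≈_
_≈_ : ∀ {n} → GA n → GA n → Set
x ≈ y = ∀ g → coeff x g ≡ coeff y g

infixl 6 _⊕_
_⊕_ : ∀ {n} → GA n → GA n → GA n
x ⊕ y = x ++ y

-- product: (σ)(τ) = σ ∘ τ
infixl 7 _⊛_
_⊛_ : ∀ {n} → GA n → GA n → GA n
x ⊛ y = concatMap (λ { (a , σ) → map (λ { (b , τ) → (a ℤ.* b , λ i → σ (τ i)) }) y }) x

basis : ∀ {n} → Perm n → GA n
basis σ = [ (ℤ.1ℤ , σ) ]

-- Tableaux. A tableau with entries 1..n is given by the position
-- pos i = (row , column) (0-indexed) of each entry i.

Shape : Set
Shape = List ℕ

InShape : Shape → ℕ × ℕ → Set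
InShape [] _ = ⊥
InShape (l ∷ λ') (zero , c) = c < l
InShape (l ∷ λ') (suc r , c) = InShape λ' (r , c)

IsTableau : ∀ {n} → Shape → (Fin n → ℕ × ℕ) → Set
IsTableau {n} λ' pos =
  (sum λ' ≡ n) × (∀ i j → pos i ≡ pos j → i ≡ j) × (∀ i → InShape λ' (pos i))

hook : ℕ → ℕ → Shape
hook n k = k ∷ replicate (n ∸ k) 1

rowGroup : ∀ {n} → (Fin n → ℕ × ℕ) → List (Perm n)
rowGroup {n} pos = filter (λ σ → all? λ i → proj₁ (pos (σ i)) ℕ.≟ proj₁ (pos i)) (allPerms n)

colGroup : ∀ {n} → (Fin n → ℕ × ℕ) → List (Perm n)
colGroup {n} pos = filter (λ σ → all? λ i → proj₂ (pos (σ i)) ℕ.≟ proj₂ (pos i)) (allPerms n)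

youngSym : ∀ {n} → (Fin n → ℕ × ℕ) → GA n
youngSym pos = map (λ σ → sign σ , σ) (rowGroup pos) ⊛ map (λ τ → ℤ.1ℤ , τ) (colGroup pos)

swapEntries : ∀ {n} → (Fin n → ℕ × ℕ) → Fin n → Fin n → (Fin n → ℕ × ℕ)
swapEntries pos e f i = pos (transposition e f i)

sumOver : ∀ {n} → Subset n → (Fin n → GA n) → GA n
sumOver {n} S F = concatMap F (filter (_∈? S) (allFin n))

module Submission where

-- Interchanging e and f conjugates c_S by t = (e f), so the
-- right-hand side is Σ_{f∈S} t·c_S and the claim reads X·C = 0 for
-- X = (1 - Σ_{f∈S} (e f))·R.  Let s₀ be the corner entry (row 0, column 0)
-- and u = (e s₀); both e and s₀ lie in column 0, so u·C = C.  On the other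
-- hand X·u = -X: writing σ·u = (e σs₀)·σ for row permutations σ, and pairing
-- the terms (σ, f) with f ≠ σs₀ with ((f σs₀)·σ, σs₀), which carry opposite
-- signs, turns X·u into -X.  Hence X·C = X·u·C = -X·C, so X·C = 0.

open import Defs
open import Data.Nat as ℕ using (ℕ; zero; suc)
import Data.Nat.Properties as ℕP
open import Data.Nat.ListAction using (sum)
open import Data.Integer as ℤ using (ℤ; 0ℤ; 1ℤ; -1ℤ; _+_; _*_; -_; _-_; _≤_)
open import Data.Integer.Properties
  using (+-identityˡ; +-identityʳ; *-identityˡ; *-identityʳ; *-zeroʳ; +-assoc; +-comm; *-assoc; *-comm;
         *-distribˡ-+; *-distribʳ-+; neg-distrib-+; neg-distribʳ-*; +-inverseʳ; +-mono-≤; *-cancelˡ-≡;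
         pos-+; pos-*; i-j≡0⇒i≡j; -1*i≡-i; +-injective; 0≤i⇒+∣i∣≡i; ^-distribˡ-+-*; ^-*-assoc; ^-zeroˡ)
open import Data.Integer.Tactic.RingSolver using (solve-∀)
open import Data.Fin as F using (Fin; _≟_; toℕ)
open import Data.Fin.Properties as FP using (all?; any?; suc-injective; _<?_; <-cmp; punchOut-injective; injective⇒≤)
open import Data.Fin.Subset using (Subset; _∈_; _∉_; Nonempty; ∣_∣)
open import Data.Fin.Subset.Properties using (_∈?_)
open import Data.Vec using (Vec; []; _∷_; lookup; tabulate)
open import Data.Vec.Properties using (lookup∘tabulate)
import Data.List.Properties as LP
open import Data.List using (List; []; _∷_; map; concatMap; filter; _++_; allFin; length; replicate)
open import Data.Product using (_×_; _,_; proj₁; proj₂; Σ)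
open import Data.Sum using (_⊎_; inj₁; inj₂)
open import Data.Empty using (⊥; ⊥-elim)
open import Function using (_∘_)
open import Relation.Nullary using (Dec; yes; no; ¬_)
open import Relation.Nullary.Decidable using (_×-dec_; ¬?)
open import Relation.Unary using (Pred; Decidable)
open import Relation.Binary using (tri<; tri≈; tri>)
open import Relation.Binary.PropositionalEquality

⟦_⟧ : ∀ {p} {P : Set p} → Dec P → ℤ
⟦ yes _ ⟧ = 1ℤ
⟦ no _ ⟧ = 0ℤ

⟦⟧-cong : ∀ {p q} {P : Set p} {Q : Set q} → (P → Q) → (Q → P) → (d : Dec P) (d' : Dec Q) → ⟦ d ⟧ ≡ ⟦ d' ⟧
⟦⟧-cong f g (yes p) (yes q) = refl
⟦⟧-cong f g (yes p) (no ¬q) = ⊥-elim (¬q (f p))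
⟦⟧-cong f g (no ¬p) (yes q) = ⊥-elim (¬p (g q))
⟦⟧-cong f g (no ¬p) (no ¬q) = refl

⟦⟧-yes : ∀ {p} {P : Set p} → P → (d : Dec P) → ⟦ d ⟧ ≡ 1ℤ
⟦⟧-yes p (yes _) = refl
⟦⟧-yes p (no ¬p) = ⊥-elim (¬p p)

⟦⟧-no : ∀ {p} {P : Set p} → ¬ P → (d : Dec P) → ⟦ d ⟧ ≡ 0ℤ
⟦⟧-no ¬p (yes p) = ⊥-elim (¬p p)
⟦⟧-no ¬p (no _) = refl

⟦⟧-× : ∀ {p q} {P : Set p} {Q : Set q} (d : Dec P) (d' : Dec Q) → ⟦ d ×-dec d' ⟧ ≡ ⟦ d ⟧ * ⟦ d' ⟧
⟦⟧-× (yes _) (yes _) = refl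
⟦⟧-× (yes _) (no _) = refl
⟦⟧-× (no _) (yes _) = refl
⟦⟧-× (no _) (no _) = refl

⟦⟧-¬ : ∀ {p} {P : Set p} (d : Dec P) → ⟦ d ⟧ + ⟦ ¬? d ⟧ ≡ 1ℤ
⟦⟧-¬ (yes _) = refl
⟦⟧-¬ (no _) = refl

⟦⟧-nonneg : ∀ {p} {P : Set p} (d : Dec P) → 0ℤ ≤ ⟦ d ⟧
⟦⟧-nonneg (yes _) = ℤ.+≤+ ℕ.z≤n
⟦⟧-nonneg (no _) = ℤ.+≤+ ℕ.z≤n

double-injective : ∀ (a b : ℤ) → a + a ≡ b + b → a ≡ b
double-injective a b eq = *-cancelˡ-≡ (ℤ.+ 2) a b (trans (double a) (trans eq (sym (double b))))
  where
  double : ∀ (x : ℤ) → ℤ.+ 2 * x ≡ x + x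
  double = solve-∀

x≡-x⇒x≡0 : ∀ {x} → x ≡ - x → x ≡ 0ℤ
x≡-x⇒x≡0 {x} eq = double-injective x 0ℤ (trans (cong (x +_) eq) (+-inverseʳ x))

ΣL : ∀ {a} {A : Set a} → List A → (A → ℤ) → ℤ
ΣL [] f = 0ℤ
ΣL (x ∷ xs) f = f x + ΣL xs f

module _ {a} {A : Set a} where

  ΣL-cong : ∀ (L : List A) {f g : A → ℤ} → (∀ x → f x ≡ g x) → ΣL L f ≡ ΣL L g
  ΣL-cong [] eq = refl
  ΣL-cong (x ∷ L) eq = cong₂ _+_ (eq x) (ΣL-cong L eq)

  ΣL-0 : ∀ (L : List A) → ΣL L (λ _ → 0ℤ) ≡ 0ℤ
  ΣL-0 [] = refl
  ΣL-0 (x ∷ L) = trans (+-identityˡ _) (ΣL-0 L)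

  ΣL-+ : ∀ (L : List A) (f g : A → ℤ) → ΣL L (λ x → f x + g x) ≡ ΣL L f + ΣL L g
  ΣL-+ [] f g = refl
  ΣL-+ (x ∷ L) f g = trans (cong ((f x + g x) +_) (ΣL-+ L f g)) (interchange (f x) (g x) (ΣL L f) (ΣL L g))
    where
    interchange : ∀ (a b c d : ℤ) → (a + b) + (c + d) ≡ (a + c) + (b + d)
    interchange = solve-∀

  ΣL-* : ∀ (L : List A) (c : ℤ) (f : A → ℤ) → ΣL L (λ x → c * f x) ≡ c * ΣL L f
  ΣL-* [] c f = sym (*-zeroʳ c)
  ΣL-* (x ∷ L) c f = trans (cong (c * f x +_) (ΣL-* L c f)) (sym (*-distribˡ-+ c (f x) (ΣL L f)))

  ΣL-neg : ∀ (L : List A) (f : A → ℤ) → ΣL L (λ x → - f x) ≡ - ΣL L f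
  ΣL-neg [] f = refl
  ΣL-neg (x ∷ L) f = trans (cong (- f x +_) (ΣL-neg L f)) (sym (neg-distrib-+ (f x) (ΣL L f)))

  ΣL-nonneg : ∀ (L : List A) (f : A → ℤ) → (∀ x → 0ℤ ≤ f x) → 0ℤ ≤ ΣL L f
  ΣL-nonneg [] f h = ℤ.+≤+ ℕ.z≤n
  ΣL-nonneg (x ∷ L) f h = +-mono-≤ (h x) (ΣL-nonneg L f h)

  ΣL-++ : ∀ (L M : List A) (f : A → ℤ) → ΣL (L ++ M) f ≡ ΣL L f + ΣL M f
  ΣL-++ [] M f = sym (+-identityˡ _)
  ΣL-++ (x ∷ L) M f = trans (cong (f x +_) (ΣL-++ L M f)) (sym (+-assoc (f x) _ _))

  ΣL-filter : ∀ {p} {P : Pred A p} (P? : Decidable P) (L : List A) (f : A → ℤ) →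
    ΣL (filter P? L) f ≡ ΣL L (λ x → ⟦ P? x ⟧ * f x)
  ΣL-filter P? [] f = refl
  ΣL-filter P? (x ∷ L) f with P? x
  ... | yes _ = cong₂ _+_ (sym (*-identityˡ (f x))) (ΣL-filter P? L f)
  ... | no _ = trans (ΣL-filter P? L f) (sym (+-identityˡ _))

  length-filter : ∀ {p} {P : Pred A p} (P? : Decidable P) (L : List A) →
    ℤ.+ (length (filter P? L)) ≡ ΣL L (λ x → ⟦ P? x ⟧)
  length-filter P? [] = refl
  length-filter P? (x ∷ L) with P? x
  ... | yes _ = trans (pos-+ 1 (length (filter P? L))) (cong (1ℤ +_) (length-filter P? L))
  ... | no _ = trans (length-filter P? L) (sym (+-identityˡ _))

module _ {a b} {A : Set a} {B : Set b} where

  ΣL-map : ∀ (g : A → B) (L : List A) (f : B → ℤ) → ΣL (map g L) f ≡ ΣL L (f ∘ g)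
  ΣL-map g [] f = refl
  ΣL-map g (x ∷ L) f = cong (f (g x) +_) (ΣL-map g L f)

  ΣL-concatMap : ∀ (g : A → List B) (L : List A) (f : B → ℤ) →
    ΣL (concatMap g L) f ≡ ΣL L (λ x → ΣL (g x) f)
  ΣL-concatMap g [] f = refl
  ΣL-concatMap g (x ∷ L) f = trans (ΣL-++ (g x) (concatMap g L) f) (cong (ΣL (g x) f +_) (ΣL-concatMap g L f))

  ΣL-swap : ∀ (L : List A) (M : List B) (f : A → B → ℤ) →
    ΣL L (λ x → ΣL M (λ y → f x y)) ≡ ΣL M (λ y → ΣL L (λ x → f x y))
  ΣL-swap [] M f = sym (ΣL-0 M)
  ΣL-swap (x ∷ L) M f = trans (cong (ΣL M (f x) +_) (ΣL-swap L M f))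
                          (sym (ΣL-+ M (f x) (λ y → ΣL L (λ x → f x y))))

ΣF : ∀ {n} → (Fin n → ℤ) → ℤ
ΣF {n} = ΣL (allFin n)

ΣF-cong : ∀ {n} {f g : Fin n → ℤ} → (∀ i → f i ≡ g i) → ΣF f ≡ ΣF g
ΣF-cong {n} = ΣL-cong (allFin n)

ΣF-suc : ∀ {n} (f : Fin (suc n) → ℤ) → ΣF f ≡ f F.zero + ΣF (f ∘ F.suc)
ΣF-suc {n} f = cong (f F.zero +_)
  (trans (cong (λ l → ΣL l f) (sym (LP.map-tabulate (λ i → i) F.suc))) (ΣL-map F.suc (allFin n) f))

ΣF-delta : ∀ {n} (j : Fin n) (f : Fin n → ℤ) → ΣF (λ i → ⟦ i ≟ j ⟧ * f i) ≡ f j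
ΣF-delta {suc n} F.zero f = begin
    ΣF (λ i → ⟦ i ≟ F.zero ⟧ * f i)
      ≡⟨ ΣF-suc (λ i → ⟦ i ≟ F.zero ⟧ * f i) ⟩
    1ℤ * f F.zero + ΣF (λ i → ⟦ F.suc i ≟ F.zero ⟧ * f (F.suc i))
      ≡⟨ cong₂ _+_ (*-identityˡ (f F.zero)) (ΣF-cong λ i → cong (_* f (F.suc i)) (⟦⟧-no (λ ()) (F.suc i ≟ F.zero))) ⟩
    f F.zero + ΣF (λ i → 0ℤ * f (F.suc i))
      ≡⟨ cong (f F.zero +_) (ΣL-0 (allFin n)) ⟩
    f F.zero + 0ℤ
      ≡⟨ +-identityʳ _ ⟩
    f F.zero ∎
  where open ≡-Reasoning
ΣF-delta {suc n} (F.suc j) f = begin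
    ΣF (λ i → ⟦ i ≟ F.suc j ⟧ * f i)
      ≡⟨ ΣF-suc (λ i → ⟦ i ≟ F.suc j ⟧ * f i) ⟩
    ⟦ F.zero ≟ F.suc j ⟧ * f F.zero + ΣF (λ i → ⟦ F.suc i ≟ F.suc j ⟧ * f (F.suc i))
      ≡⟨ cong₂ _+_ (cong (_* f F.zero) (⟦⟧-no (λ ()) (F.zero ≟ F.suc j)))
                   (ΣF-cong λ i → cong (_* f (F.suc i)) (⟦⟧-cong suc-injective (cong F.suc) (F.suc i ≟ F.suc j) (i ≟ j))) ⟩
    0ℤ + ΣF (λ i → ⟦ i ≟ j ⟧ * f (F.suc i))
      ≡⟨ +-identityˡ _ ⟩
    ΣF (λ i → ⟦ i ≟ j ⟧ * f (F.suc i))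
      ≡⟨ ΣF-delta j (λ i → f (F.suc i)) ⟩
    f (F.suc j) ∎
  where open ≡-Reasoning

ΣF-split : ∀ {n} (c : Fin n) (F : Fin n → ℤ) → ΣF F ≡ F c + ΣF (λ f → ⟦ ¬? (f ≟ c) ⟧ * F f)
ΣF-split {n} c F = begin
    ΣF F
      ≡⟨ ΣF-cong (λ f → trans (sym (*-identityˡ (F f))) (trans (cong (_* F f) (sym (⟦⟧-¬ (f ≟ c)))) (*-distribʳ-+ (F f) ⟦ f ≟ c ⟧ _))) ⟩
    ΣF (λ f → ⟦ f ≟ c ⟧ * F f + ⟦ ¬? (f ≟ c) ⟧ * F f)
      ≡⟨ ΣL-+ (allFin n) (λ f → ⟦ f ≟ c ⟧ * F f) (λ f → ⟦ ¬? (f ≟ c) ⟧ * F f) ⟩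
    ΣF (λ f → ⟦ f ≟ c ⟧ * F f) + ΣF (λ f → ⟦ ¬? (f ≟ c) ⟧ * F f)
      ≡⟨ cong (_+ ΣF (λ f → ⟦ ¬? (f ≟ c) ⟧ * F f)) (ΣF-delta c F) ⟩
    F c + ΣF (λ f → ⟦ ¬? (f ≟ c) ⟧ * F f) ∎
  where open ≡-Reasoning

-- A finite enumeration of A up to a decidable equivalence: the list `elems`
-- meets every equivalence class exactly once, which is expressed by the
-- sifting property `delta` of the Kronecker delta of ~.  Maps Fin n → Fin n
-- are only enumerable up to pointwise equality, hence the setoid.
record Enumeration (A : Set) : Set₁ where
  field
    _~_ : A → A → Set
    _~?_ : ∀ a b → Dec (a ~ b)
    ~refl : ∀ {a} → a ~ a
    ~sym : ∀ {a b} → a ~ b → b ~ a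
    ~trans : ∀ {a b c} → a ~ b → b ~ c → a ~ c
    elems : List A

  Respects : (A → ℤ) → Set
  Respects H = ∀ {a b} → a ~ b → H a ≡ H b

  field
    delta : ∀ (H : A → ℤ) → Respects H → ∀ b → ΣL elems (λ a → ⟦ a ~? b ⟧ * H a) ≡ H b

module Reindexing {A : Set} (E : Enumeration A) where
  open Enumeration E

  Σₑ : (A → ℤ) → ℤ
  Σₑ = ΣL elems

  count : ∀ b → Σₑ (λ a → ⟦ a ~? b ⟧) ≡ 1ℤ
  count b = trans (ΣL-cong elems (λ a → sym (*-identityʳ ⟦ a ~? b ⟧))) (delta (λ _ → 1ℤ) (λ _ → refl) b)

  Bijective : (A → A) → Set
  Bijective Φ = ∀ b → Σ A λ a₀ → ∀ a → (Φ a ~ b → a ~ a₀) × (a ~ a₀ → Φ a ~ b)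

  reindex : (Φ : A → A) → Bijective Φ → (H : A → ℤ) → Respects H → Σₑ (λ a → H (Φ a)) ≡ Σₑ H
  reindex Φ bij H rH = begin
      Σₑ (λ a → H (Φ a))
        ≡⟨ ΣL-cong elems (λ a → sym (delta H rH (Φ a))) ⟩
      Σₑ (λ a → Σₑ (λ b → ⟦ b ~? Φ a ⟧ * H b))
        ≡⟨ ΣL-swap elems elems _ ⟩
      Σₑ (λ b → Σₑ (λ a → ⟦ b ~? Φ a ⟧ * H b))
        ≡⟨ ΣL-cong elems (λ b → ΣL-cong elems (λ a → trans (cong (_* H b) (preimage b a)) (*-comm _ (H b)))) ⟩
      Σₑ (λ b → Σₑ (λ a → H b * ⟦ a ~? proj₁ (bij b) ⟧))
        ≡⟨ ΣL-cong elems (λ b → trans (ΣL-* elems (H b) _) (trans (cong (H b *_) (count (proj₁ (bij b)))) (*-identityʳ (H b)))) ⟩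
      Σₑ H ∎
    where
    open ≡-Reasoning
    preimage : ∀ b a → ⟦ b ~? Φ a ⟧ ≡ ⟦ a ~? proj₁ (bij b) ⟧
    preimage b a = ⟦⟧-cong (λ x → proj₁ (proj₂ (bij b) a) (~sym x)) (λ y → ~sym (proj₂ (proj₂ (bij b) a) y)) _ _

  involution-bijective : (Φ : A → A) → (∀ {a b} → a ~ b → Φ a ~ Φ b) → (∀ a → Φ (Φ a) ~ a) → Bijective Φ
  involution-bijective Φ resp inv b = Φ b , λ a → (λ x → ~trans (~sym (inv a)) (resp x)) , (λ y → ~trans (resp y) (inv b))

  antisymmetric-sum : (Φ : A → A) → (∀ {a b} → a ~ b → Φ a ~ Φ b) → (∀ a → Φ (Φ a) ~ a) →
    (H : A → ℤ) → Respects H → (∀ a → H (Φ a) ≡ - H a) → Σₑ H ≡ 0ℤ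
  antisymmetric-sum Φ resp inv H rH anti = x≡-x⇒x≡0 (begin
      Σₑ H ≡⟨ sym (reindex Φ (involution-bijective Φ resp inv) H rH) ⟩
      Σₑ (λ a → H (Φ a)) ≡⟨ ΣL-cong elems anti ⟩
      Σₑ (λ a → - H a) ≡⟨ ΣL-neg elems H ⟩
      - Σₑ H ∎)
    where open ≡-Reasoning

pairs : ∀ {A B : Set} → List A → List B → List (A × B)
pairs L M = concatMap (λ a → map (a ,_) M) L

ΣL-pairs : ∀ {A B : Set} (L : List A) (M : List B) (f : A × B → ℤ) → ΣL (pairs L M) f ≡ ΣL L (λ a → ΣL M (λ b → f (a , b)))
ΣL-pairs L M f = trans (ΣL-concatMap _ L f) (ΣL-cong L (λ a → ΣL-map (a ,_) M f))

product-enumeration : ∀ {A B : Set} → Enumeration A → Enumeration B → Enumeration (A × B)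
product-enumeration {A} {B} EA EB = record
  { _~_ = λ p q → (proj₁ p A.~ proj₁ q) × (proj₂ p B.~ proj₂ q)
  ; _~?_ = λ p q → (proj₁ p A.~? proj₁ q) ×-dec (proj₂ p B.~? proj₂ q)
  ; ~refl = A.~refl , B.~refl
  ; ~sym = λ x → A.~sym (proj₁ x) , B.~sym (proj₂ x)
  ; ~trans = λ x y → A.~trans (proj₁ x) (proj₁ y) , B.~trans (proj₂ x) (proj₂ y)
  ; elems = pairs A.elems B.elems
  ; delta = pair-delta
  }
  where
  module A = Enumeration EA
  module B = Enumeration EB
  pair-delta : ∀ (H : A × B → ℤ) → (∀ {p q} → (proj₁ p A.~ proj₁ q) × (proj₂ p B.~ proj₂ q) → H p ≡ H q) →
    ∀ q → ΣL (pairs A.elems B.elems) (λ p → ⟦ (proj₁ p A.~? proj₁ q) ×-dec (proj₂ p B.~? proj₂ q) ⟧ * H p) ≡ H q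
  pair-delta H rH (a₀ , b₀) = begin
      ΣL (pairs A.elems B.elems) (λ p → ⟦ (proj₁ p A.~? a₀) ×-dec (proj₂ p B.~? b₀) ⟧ * H p)
        ≡⟨ ΣL-pairs A.elems B.elems _ ⟩
      ΣL A.elems (λ a → ΣL B.elems (λ b → ⟦ (a A.~? a₀) ×-dec (b B.~? b₀) ⟧ * H (a , b)))
        ≡⟨ ΣL-cong A.elems (λ a → ΣL-cong B.elems (λ b →
             trans (cong (_* H (a , b)) (⟦⟧-× (a A.~? a₀) (b B.~? b₀))) (*-assoc ⟦ a A.~? a₀ ⟧ _ _))) ⟩
      ΣL A.elems (λ a → ΣL B.elems (λ b → ⟦ a A.~? a₀ ⟧ * (⟦ b B.~? b₀ ⟧ * H (a , b))))
        ≡⟨ ΣL-cong A.elems (λ a → ΣL-* B.elems ⟦ a A.~? a₀ ⟧ _) ⟩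
      ΣL A.elems (λ a → ⟦ a A.~? a₀ ⟧ * ΣL B.elems (λ b → ⟦ b B.~? b₀ ⟧ * H (a , b)))
        ≡⟨ ΣL-cong A.elems (λ a → cong (⟦ a A.~? a₀ ⟧ *_) (B.delta (λ b → H (a , b)) (λ x → rH (A.~refl , x)) b₀)) ⟩
      ΣL A.elems (λ a → ⟦ a A.~? a₀ ⟧ * H (a , b₀))
        ≡⟨ A.delta (λ a → H (a , b₀)) (λ x → rH (x , B.~refl)) a₀ ⟩
      H (a₀ , b₀) ∎
    where open ≡-Reasoning

fin-enumeration : ∀ n → Enumeration (Fin n)
fin-enumeration n = record
  { _~_ = _≡_ ; _~?_ = _≟_ ; ~refl = refl ; ~sym = sym ; ~trans = trans
  ; elems = allFin n
  ; delta = λ H _ b → ΣF-delta b H }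

infix 4 _≐_
_≐_ : ∀ {n} → Perm n → Perm n → Set
σ ≐ τ = ∀ i → σ i ≡ τ i

_≐?_ : ∀ {n} (σ τ : Perm n) → Dec (σ ≐ τ)
σ ≐? τ = all? (λ i → σ i ≟ τ i)

∘-cong : ∀ {n} {σ σ' τ τ' : Perm n} → σ ≐ σ' → τ ≐ τ' → (σ ∘ τ) ≐ (σ' ∘ τ')
∘-cong {σ' = σ'} e₁ e₂ i = trans (e₁ _) (cong σ' (e₂ i))

allVecs-delta : ∀ {n} m (g : Fin m → Fin n) (H : Vec (Fin n) m → ℤ) →
  (∀ {v w} → (∀ i → lookup v i ≡ lookup w i) → H v ≡ H w) →
  ΣL (allVecs n m) (λ v → ⟦ all? (λ i → lookup v i ≟ g i) ⟧ * H v) ≡ H (tabulate g)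
allVecs-delta zero g H rH = trans (cong (λ z → z * H [] + 0ℤ) (⟦⟧-yes (λ ()) (all? (λ i → lookup [] i ≟ g i))))
                                 (trans (+-identityʳ _) (*-identityˡ _))
allVecs-delta {n} (suc m) g H rH = begin
    ΣL (concatMap (λ i → map (i ∷_) (allVecs n m)) (allFin n)) term
      ≡⟨ ΣL-concatMap _ (allFin n) term ⟩
    ΣF (λ i → ΣL (map (i ∷_) (allVecs n m)) term)
      ≡⟨ ΣF-cong (λ i → ΣL-map (i ∷_) (allVecs n m) term) ⟩
    ΣF (λ i → ΣL (allVecs n m) (λ w → term (i ∷ w)))
      ≡⟨ ΣF-cong (λ i → ΣL-cong (allVecs n m) (λ w → trans (cong (_* H (i ∷ w)) (head-tail i w)) (*-assoc ⟦ i ≟ g F.zero ⟧ _ _))) ⟩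
    ΣF (λ i → ΣL (allVecs n m) (λ w → ⟦ i ≟ g F.zero ⟧ * (⟦ tail? w ⟧ * H (i ∷ w))))
      ≡⟨ ΣF-cong (λ i → ΣL-* (allVecs n m) ⟦ i ≟ g F.zero ⟧ _) ⟩
    ΣF (λ i → ⟦ i ≟ g F.zero ⟧ * ΣL (allVecs n m) (λ w → ⟦ tail? w ⟧ * H (i ∷ w)))
      ≡⟨ ΣF-cong (λ i → cong (⟦ i ≟ g F.zero ⟧ *_)
           (allVecs-delta m (g ∘ F.suc) (λ w → H (i ∷ w)) (λ e → rH (λ { F.zero → refl ; (F.suc k) → e k })))) ⟩
    ΣF (λ i → ⟦ i ≟ g F.zero ⟧ * H (i ∷ tabulate (g ∘ F.suc)))
      ≡⟨ ΣF-delta (g F.zero) (λ i → H (i ∷ tabulate (g ∘ F.suc))) ⟩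
    H (tabulate g) ∎
  where
  open ≡-Reasoning
  term : Vec (Fin n) (suc m) → ℤ
  term v = ⟦ all? (λ i → lookup v i ≟ g i) ⟧ * H v
  tail? : (w : Vec (Fin n) m) → Dec (∀ k → lookup w k ≡ g (F.suc k))
  tail? w = all? (λ k → lookup w k ≟ g (F.suc k))
  head-tail : ∀ i w → ⟦ all? (λ k → lookup (i ∷ w) k ≟ g k) ⟧ ≡ ⟦ i ≟ g F.zero ⟧ * ⟦ tail? w ⟧
  head-tail i w = trans (⟦⟧-cong (λ e → e F.zero , e ∘ F.suc) (λ { (e , _) F.zero → e ; (_ , e) (F.suc k) → e k })
                                 (all? (λ k → lookup (i ∷ w) k ≟ g k)) ((i ≟ g F.zero) ×-dec tail? w))
                        (⟦⟧-× (i ≟ g F.zero) (tail? w))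

map-enumeration : ∀ n → Enumeration (Perm n)
map-enumeration n = record
  { _~_ = _≐_ ; _~?_ = _≐?_ ; ~refl = λ _ → refl ; ~sym = λ e i → sym (e i) ; ~trans = λ e e' i → trans (e i) (e' i)
  ; elems = allFuns n
  ; delta = λ H rH g → trans (ΣL-map lookup (allVecs n n) (λ σ → ⟦ σ ≐? g ⟧ * H σ))
                      (trans (allVecs-delta n g (λ v → H (lookup v)) rH) (rH (lookup∘tabulate g)))
  }

ΣP : ∀ {n} → (Perm n → ℤ) → ℤ
ΣP {n} = ΣL (allFuns n)

ΣP-cong : ∀ {n} {f g : Perm n → ℤ} → (∀ σ → f σ ≡ g σ) → ΣP f ≡ ΣP g
ΣP-cong {n} = ΣL-cong (allFuns n)

-- Injective endomaps of Fin n are surjective (pigeonhole, via punchOut).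
injective⇒surjective : ∀ {n} (τ : Perm n) → IsPerm τ → ∀ b → Σ (Fin n) (λ a → τ a ≡ b)
injective⇒surjective {suc m} τ inj b with any? (λ a → τ a ≟ b)
... | yes p = p
... | no ¬p = ⊥-elim (ℕP.<-irrefl refl (injective⇒≤ {f = squeeze} squeeze-injective))
  where
  missed : ∀ a → b ≢ τ a
  missed a eq = ¬p (a , sym eq)
  squeeze : Fin (suc m) → Fin m
  squeeze a = F.punchOut (missed a)
  squeeze-injective : ∀ {x y} → squeeze x ≡ squeeze y → x ≡ y
  squeeze-injective {x} {y} eq = inj x y (punchOut-injective (missed x) (missed y) eq)

ΣF-permute : ∀ {n} (τ : Perm n) → IsPerm τ → (H : Fin n → ℤ) → ΣF (H ∘ τ) ≡ ΣF H
ΣF-permute {n} τ inj H = Reindexing.reindex (fin-enumeration n) τ bijective H (cong H)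
  where
  bijective : Reindexing.Bijective (fin-enumeration n) τ
  bijective b with injective⇒surjective τ inj b
  ... | a₀ , e = a₀ , λ a → (λ x → inj a a₀ (trans x (sym e))) , (λ { refl → e })

lt : ∀ {n} → Fin n → Fin n → ℤ
lt i j = ⟦ i <? j ⟧

Σ< : ∀ {n} → (Fin n → Fin n → ℤ) → ℤ
Σ< k = ΣF (λ i → ΣF (λ j → lt i j * k i j))

Σ≠ : ∀ {n} → (Fin n → Fin n → ℤ) → ℤ
Σ≠ k = ΣF (λ i → ΣF (λ j → ⟦ ¬? (i ≟ j) ⟧ * k i j))

Σ<-cong : ∀ {n} {k k' : Fin n → Fin n → ℤ} → (∀ i j → lt i j * k i j ≡ lt i j * k' i j) → Σ< k ≡ Σ< k'
Σ<-cong e = ΣF-cong λ i → ΣF-cong λ j → e i j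

Σ<-+ : ∀ {n} (k k' : Fin n → Fin n → ℤ) → Σ< (λ i j → k i j + k' i j) ≡ Σ< k + Σ< k'
Σ<-+ {n} k k' = trans (ΣF-cong λ i → trans (ΣF-cong λ j → *-distribˡ-+ (lt i j) (k i j) (k' i j)) (ΣL-+ (allFin n) _ _))
                      (ΣL-+ (allFin n) _ _)

Σ<-* : ∀ {n} (c : ℤ) (k : Fin n → Fin n → ℤ) → Σ< (λ i j → c * k i j) ≡ c * Σ< k
Σ<-* {n} c k = trans (ΣF-cong λ i → trans (ΣF-cong λ j → swap-scalar (lt i j) c (k i j)) (ΣL-* (allFin n) c _))
                     (ΣL-* (allFin n) c _)
  where
  swap-scalar : ∀ (a c x : ℤ) → a * (c * x) ≡ c * (a * x)
  swap-scalar = solve-∀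

lt-trichotomy : ∀ {n} (i j : Fin n) → lt i j + lt j i ≡ ⟦ ¬? (i ≟ j) ⟧
lt-trichotomy i j with <-cmp i j
... | tri< a ¬b ¬c rewrite ⟦⟧-yes a (i <? j) | ⟦⟧-no ¬c (j <? i) | ⟦⟧-yes ¬b (¬? (i ≟ j)) = refl
... | tri≈ ¬a b ¬c rewrite ⟦⟧-no ¬a (i <? j) | ⟦⟧-no ¬c (j <? i) | ⟦⟧-no (λ z → z b) (¬? (i ≟ j)) = refl
... | tri> ¬a ¬b c rewrite ⟦⟧-no ¬a (i <? j) | ⟦⟧-yes c (j <? i) | ⟦⟧-yes ¬b (¬? (i ≟ j)) = refl

Σ<-symmetric : ∀ {n} (k : Fin n → Fin n → ℤ) → (∀ i j → k i j ≡ k j i) → Σ< k + Σ< k ≡ Σ≠ k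
Σ<-symmetric {n} k ks = begin
    Σ< k + Σ< k
      ≡⟨ cong (Σ< k +_) (trans (ΣL-swap (allFin n) (allFin n) _) (ΣF-cong λ j → ΣF-cong λ i → cong (lt i j *_) (ks i j))) ⟩
    Σ< k + ΣF (λ i → ΣF (λ j → lt j i * k i j))
      ≡⟨ sym (ΣL-+ (allFin n) _ _) ⟩
    ΣF (λ i → ΣF (λ j → lt i j * k i j) + ΣF (λ j → lt j i * k i j))
      ≡⟨ ΣF-cong (λ i → trans (sym (ΣL-+ (allFin n) _ _)) (ΣF-cong λ j →
           trans (sym (*-distribʳ-+ (k i j) (lt i j) (lt j i))) (cong (_* k i j) (lt-trichotomy i j)))) ⟩
    Σ≠ k ∎
  where open ≡-Reasoning

Σ<-permute : ∀ {n} (τ : Perm n) → IsPerm τ → (h : Fin n → Fin n → ℤ) → (∀ i j → h i j ≡ h j i) →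
  Σ< (λ i j → h (τ i) (τ j)) ≡ Σ< h
Σ<-permute {n} τ inj h hs = double-injective _ _ (begin
    Σ< hτ + Σ< hτ
      ≡⟨ Σ<-symmetric hτ (λ i j → hs (τ i) (τ j)) ⟩
    Σ≠ hτ
      ≡⟨ ΣF-cong (λ i → ΣF-cong λ j → cong (_* hτ i j)
           (⟦⟧-cong (λ ne e → ne (inj i j e)) (λ ne e → ne (cong τ e)) (¬? (i ≟ j)) (¬? (τ i ≟ τ j)))) ⟩
    ΣF (λ i → ΣF (λ j → ⟦ ¬? (τ i ≟ τ j) ⟧ * h (τ i) (τ j)))
      ≡⟨ ΣF-cong (λ i → ΣF-permute τ inj (λ y → ⟦ ¬? (τ i ≟ y) ⟧ * h (τ i) y)) ⟩
    ΣF (λ i → ΣF (λ y → ⟦ ¬? (τ i ≟ y) ⟧ * h (τ i) y))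
      ≡⟨ ΣF-permute τ inj (λ x → ΣF (λ y → ⟦ ¬? (x ≟ y) ⟧ * h x y)) ⟩
    Σ≠ h
      ≡⟨ sym (Σ<-symmetric h hs) ⟩
    Σ< h + Σ< h ∎)
  where
  open ≡-Reasoning
  hτ : Fin n → Fin n → ℤ
  hτ i j = h (τ i) (τ j)

inversions-Σ< : ∀ {n} (σ : Perm n) → ℤ.+ (inversions σ) ≡ Σ< (λ i j → lt (σ j) (σ i))
inversions-Σ< {n} σ = begin
    ℤ.+ (inversions σ)
      ≡⟨ length-filter _ (concatMap (λ i → map (λ j → i , j) (allFin n)) (allFin n)) ⟩
    ΣL (concatMap (λ i → map (λ j → i , j) (allFin n)) (allFin n)) (λ p → ⟦ inverted? p ⟧)
      ≡⟨ ΣL-concatMap _ (allFin n) _ ⟩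
    ΣF (λ i → ΣL (map (λ j → i , j) (allFin n)) (λ p → ⟦ inverted? p ⟧))
      ≡⟨ ΣF-cong (λ i → trans (ΣL-map _ (allFin n) _) (ΣF-cong λ j → ⟦⟧-× (i <? j) (σ j <? σ i))) ⟩
    Σ< (λ i j → lt (σ j) (σ i)) ∎
  where
  open ≡-Reasoning
  inverted? : (p : Fin n × Fin n) → Dec ((proj₁ p F.< proj₂ p) × (σ (proj₂ p) F.< σ (proj₁ p)))
  inverted? p = (proj₁ p <? proj₂ p) ×-dec (σ (proj₂ p) <? σ (proj₁ p))

sign-cong : ∀ {n} {σ σ' : Perm n} → σ ≐ σ' → sign σ ≡ sign σ'
sign-cong {σ = σ} {σ'} e = cong (-1ℤ ℤ.^_) (+-injective (begin
    ℤ.+ inversions σ ≡⟨ inversions-Σ< σ ⟩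
    Σ< (λ i j → lt (σ j) (σ i)) ≡⟨ Σ<-cong (λ i j → cong₂ (λ a b → lt i j * lt a b) (e j) (e i)) ⟩
    Σ< (λ i j → lt (σ' j) (σ' i)) ≡⟨ sym (inversions-Σ< σ') ⟩
    ℤ.+ inversions σ' ∎))
  where open ≡-Reasoning

inverts : ∀ {n} → Perm n → Fin n → Fin n → ℤ
inverts σ x y = lt x y * lt (σ y) (σ x) + lt y x * lt (σ x) (σ y)

inverts-symmetric : ∀ {n} (σ : Perm n) x y → inverts σ x y ≡ inverts σ y x
inverts-symmetric σ x y = +-comm (lt x y * lt (σ y) (σ x)) (lt y x * lt (σ x) (σ y))

inversions-inverts : ∀ {n} (σ : Perm n) → ℤ.+ (inversions σ) ≡ Σ< (inverts σ)
inversions-inverts {n} σ = trans (inversions-Σ< σ) (Σ<-cong on-ordered-pair)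
  where
  drop-reversed : ∀ (X Y : ℤ) → 1ℤ * X ≡ 1ℤ * (1ℤ * X + 0ℤ * Y)
  drop-reversed = solve-∀
  on-ordered-pair : ∀ i j → lt i j * lt (σ j) (σ i) ≡ lt i j * inverts σ i j
  on-ordered-pair i j with <-cmp i j
  ... | tri< a _ c rewrite ⟦⟧-yes a (i <? j) | ⟦⟧-no c (j <? i) = drop-reversed (lt (σ j) (σ i)) (lt (σ i) (σ j))
  ... | tri≈ a _ c rewrite ⟦⟧-no a (i <? j) = refl
  ... | tri> a _ c rewrite ⟦⟧-no a (i <? j) = refl

lt-complement : ∀ {n} (x y : Fin n) → x ≢ y → lt x y + lt y x ≡ 1ℤ
lt-complement x y ne = trans (lt-trichotomy x y) (⟦⟧-yes ne (¬? (x ≟ y)))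

pair-inversions : ∀ {n} (σ : Perm n) (x y : Fin n) → x ≢ y → σ x ≢ σ y →
  lt (σ y) (σ x) + lt y x ≡ inverts σ x y + ℤ.+ 2 * (lt y x * lt (σ y) (σ x))
pair-inversions σ x y ne sne =
  bits (lt x y) (lt y x) (lt (σ x) (σ y)) (lt (σ y) (σ x)) (lt-complement x y ne) (lt-complement (σ x) (σ y) sne)
  where
  identity : ∀ p q' → q' + (1ℤ - p) ≡ (p * q' + (1ℤ - p) * (1ℤ - q')) + ℤ.+ 2 * ((1ℤ - p) * q')
  identity = solve-∀
  cancel : ∀ a b → (a + b) - a ≡ b
  cancel = solve-∀
  cancel′ : ∀ a b → (a + b) - b ≡ a
  cancel′ = solve-∀
  bits : ∀ p p' q q' → p + p' ≡ 1ℤ → q + q' ≡ 1ℤ → q' + p' ≡ (p * q' + p' * q) + ℤ.+ 2 * (p' * q')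
  bits p p' q q' hp hq =
    subst₂ (λ P' Q → q' + P' ≡ (p * q' + P' * Q) + ℤ.+ 2 * (P' * q'))
           (trans (cong (_- p) (sym hp)) (cancel p p')) (trans (cong (_- q') (sym hq)) (cancel′ q q'))
           (identity p q')

-- inv(σ∘τ) + inv(τ) ≡ inv(σ) (mod 2): the pairs inverted by both τ and σ∘τ
-- are counted twice, every other pair inverted by σ once.
inversions-∘ : ∀ {n} (σ τ : Perm n) → IsPerm σ → IsPerm τ →
  Σ ℕ λ m → inversions (σ ∘ τ) ℕ.+ inversions τ ≡ inversions σ ℕ.+ 2 ℕ.* m
inversions-∘ {n} σ τ iσ iτ = ℤ.∣ W ∣ , +-injective (begin
    ℤ.+ (inversions (σ ∘ τ) ℕ.+ inversions τ)
      ≡⟨ pos-+ (inversions (σ ∘ τ)) (inversions τ) ⟩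
    ℤ.+ inversions (σ ∘ τ) + ℤ.+ inversions τ
      ≡⟨ cong₂ _+_ (inversions-Σ< (σ ∘ τ)) (inversions-Σ< τ) ⟩
    Σ< c + Σ< a
      ≡⟨ sym (Σ<-+ c a) ⟩
    Σ< (λ i j → c i j + a i j)
      ≡⟨ Σ<-cong on-ordered-pair ⟩
    Σ< (λ i j → inverts σ (τ i) (τ j) + ℤ.+ 2 * (a i j * c i j))
      ≡⟨ Σ<-+ (λ i j → inverts σ (τ i) (τ j)) (λ i j → ℤ.+ 2 * (a i j * c i j)) ⟩
    Σ< (λ i j → inverts σ (τ i) (τ j)) + Σ< (λ i j → ℤ.+ 2 * (a i j * c i j))
      ≡⟨ cong₂ _+_ (Σ<-permute τ iτ (inverts σ) (inverts-symmetric σ)) (Σ<-* (ℤ.+ 2) (λ i j → a i j * c i j)) ⟩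
    Σ< (inverts σ) + ℤ.+ 2 * W
      ≡⟨ cong₂ _+_ (sym (inversions-inverts σ)) (cong (ℤ.+ 2 *_) (sym (0≤i⇒+∣i∣≡i W≥0))) ⟩
    ℤ.+ inversions σ + ℤ.+ 2 * ℤ.+ ℤ.∣ W ∣
      ≡⟨ cong (ℤ.+ inversions σ +_) (sym (pos-* 2 ℤ.∣ W ∣)) ⟩
    ℤ.+ inversions σ + ℤ.+ (2 ℕ.* ℤ.∣ W ∣)
      ≡⟨ sym (pos-+ (inversions σ) (2 ℕ.* ℤ.∣ W ∣)) ⟩
    ℤ.+ (inversions σ ℕ.+ 2 ℕ.* ℤ.∣ W ∣) ∎)
  where
  open ≡-Reasoning
  c a : Fin n → Fin n → ℤ
  c i j = lt (σ (τ j)) (σ (τ i))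
  a i j = lt (τ j) (τ i)
  W : ℤ
  W = Σ< (λ i j → a i j * c i j)
  W≥0 : 0ℤ ≤ W
  W≥0 = ΣL-nonneg (allFin n) _ λ i → ΣL-nonneg (allFin n) _ λ j →
    subst (0ℤ ≤_) (trans (⟦⟧-× (i <? j) ((τ j <? τ i) ×-dec (σ (τ j) <? σ (τ i))))
                         (cong (lt i j *_) (⟦⟧-× (τ j <? τ i) (σ (τ j) <? σ (τ i))))) (⟦⟧-nonneg _)
  on-ordered-pair : ∀ i j → lt i j * (c i j + a i j) ≡ lt i j * (inverts σ (τ i) (τ j) + ℤ.+ 2 * (a i j * c i j))
  on-ordered-pair i j with i <? j
  ... | yes i<j = cong (1ℤ *_) (pair-inversions σ (τ i) (τ j) (λ e → FP.<⇒≢ i<j (iτ i j e))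
                                                            (λ e → FP.<⇒≢ i<j (iτ i j (iσ (τ i) (τ j) e))))
  ... | no _ = refl

-1^-square : ∀ q → -1ℤ ℤ.^ q * -1ℤ ℤ.^ q ≡ 1ℤ
-1^-square zero = refl
-1^-square (suc q) = trans (square-neg (-1ℤ ℤ.^ q)) (-1^-square q)
  where
  square-neg : ∀ (x : ℤ) → (-1ℤ * x) * (-1ℤ * x) ≡ x * x
  square-neg = solve-∀

-1^-parity : ∀ p q r m → p ℕ.+ q ≡ r ℕ.+ 2 ℕ.* m → -1ℤ ℤ.^ p ≡ -1ℤ ℤ.^ r * -1ℤ ℤ.^ q
-1^-parity p q r m eq = begin
    -1ℤ ℤ.^ p ≡⟨ sym (*-identityʳ _) ⟩
    -1ℤ ℤ.^ p * 1ℤ ≡⟨ cong (-1ℤ ℤ.^ p *_) (sym (-1^-square q)) ⟩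
    -1ℤ ℤ.^ p * (-1ℤ ℤ.^ q * -1ℤ ℤ.^ q) ≡⟨ sym (*-assoc (-1ℤ ℤ.^ p) _ _) ⟩
    (-1ℤ ℤ.^ p * -1ℤ ℤ.^ q) * -1ℤ ℤ.^ q ≡⟨ cong (_* -1ℤ ℤ.^ q) (sym (^-distribˡ-+-* -1ℤ p q)) ⟩
    -1ℤ ℤ.^ (p ℕ.+ q) * -1ℤ ℤ.^ q ≡⟨ cong (λ k → -1ℤ ℤ.^ k * -1ℤ ℤ.^ q) eq ⟩
    -1ℤ ℤ.^ (r ℕ.+ 2 ℕ.* m) * -1ℤ ℤ.^ q ≡⟨ cong (_* -1ℤ ℤ.^ q) (^-distribˡ-+-* -1ℤ r (2 ℕ.* m)) ⟩
    (-1ℤ ℤ.^ r * -1ℤ ℤ.^ (2 ℕ.* m)) * -1ℤ ℤ.^ q ≡⟨ cong (λ z → (-1ℤ ℤ.^ r * z) * -1ℤ ℤ.^ q) (trans (sym (^-*-assoc -1ℤ 2 m)) (^-zeroˡ m)) ⟩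
    (-1ℤ ℤ.^ r * 1ℤ) * -1ℤ ℤ.^ q ≡⟨ cong (_* -1ℤ ℤ.^ q) (*-identityʳ (-1ℤ ℤ.^ r)) ⟩
    -1ℤ ℤ.^ r * -1ℤ ℤ.^ q ∎
  where open ≡-Reasoning

sign-∘ : ∀ {n} (σ τ : Perm n) → IsPerm σ → IsPerm τ → sign (σ ∘ τ) ≡ sign σ * sign τ
sign-∘ σ τ iσ iτ =
  -1^-parity (inversions (σ ∘ τ)) (inversions τ) (inversions σ) (proj₁ parity) (proj₂ parity)
  where
  parity : Σ ℕ λ m → inversions (σ ∘ τ) ℕ.+ inversions τ ≡ inversions σ ℕ.+ 2 ℕ.* m
  parity = inversions-∘ σ τ iσ iτ

sign-square : ∀ {n} (σ : Perm n) → sign σ * sign σ ≡ 1ℤ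
sign-square σ = -1^-square (inversions σ)

∘-IsPerm : ∀ {n} (σ τ : Perm n) → IsPerm σ → IsPerm τ → IsPerm (σ ∘ τ)
∘-IsPerm σ τ iσ iτ x y e = iτ x y (iσ _ _ e)

module _ {n : ℕ} where

  transposition-view : ∀ (a b x : Fin n) →
    (x ≡ a × transposition a b x ≡ b) ⊎ ((x ≢ a × x ≡ b) × transposition a b x ≡ a) ⊎ ((x ≢ a × x ≢ b) × transposition a b x ≡ x)
  transposition-view a b x with x ≟ a | x ≟ b
  ... | yes p | _ = inj₁ (p , refl)
  ... | no p | yes q = inj₂ (inj₁ ((p , q) , refl))
  ... | no p | no q = inj₂ (inj₂ ((p , q) , refl))

  transposition-left : ∀ (a b : Fin n) → transposition a b a ≡ b
  transposition-left a b with transposition-view a b a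
  ... | inj₁ (_ , e) = e
  ... | inj₂ (inj₁ ((p , _) , _)) = ⊥-elim (p refl)
  ... | inj₂ (inj₂ ((p , _) , _)) = ⊥-elim (p refl)

  transposition-right : ∀ (a b : Fin n) → transposition a b b ≡ a
  transposition-right a b with transposition-view a b b
  ... | inj₁ (p , e) = trans e p
  ... | inj₂ (inj₁ (_ , e)) = e
  ... | inj₂ (inj₂ ((_ , q) , _)) = ⊥-elim (q refl)

  transposition-fixes : ∀ (a b x : Fin n) → x ≢ a → x ≢ b → transposition a b x ≡ x
  transposition-fixes a b x p q with transposition-view a b x
  ... | inj₁ (p' , _) = ⊥-elim (p p')
  ... | inj₂ (inj₁ ((_ , q') , _)) = ⊥-elim (q q')
  ... | inj₂ (inj₂ (_ , e)) = e

  transposition-involutive : ∀ (a b x : Fin n) → transposition a b (transposition a b x) ≡ x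
  transposition-involutive a b x with transposition-view a b x
  ... | inj₁ (p , e) = trans (cong (transposition a b) e) (trans (transposition-right a b) (sym p))
  ... | inj₂ (inj₁ ((_ , q) , e)) = trans (cong (transposition a b) e) (trans (transposition-left a b) (sym q))
  ... | inj₂ (inj₂ (_ , e)) = trans (cong (transposition a b) e) e

  transposition-IsPerm : ∀ (a b : Fin n) → IsPerm (transposition a b)
  transposition-IsPerm a b x y e =
    trans (sym (transposition-involutive a b x)) (trans (cong (transposition a b) e) (transposition-involutive a b y))

  transposition-comm : ∀ (a b : Fin n) → transposition a b ≐ transposition b a
  transposition-comm a b x with transposition-view a b x
  ... | inj₁ (p , e) rewrite p = trans e (sym (transposition-right b a))
  ... | inj₂ (inj₁ ((_ , q) , e)) rewrite q = trans e (sym (transposition-left b a))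
  ... | inj₂ (inj₂ ((p , q) , e)) = trans e (sym (transposition-fixes b a x q p))

  transposition-conjugate : ∀ (a b c : Fin n) → a ≢ b → a ≢ c → c ≢ b →
    transposition a b ≐ (transposition a c ∘ transposition c b ∘ transposition a c)
  transposition-conjugate a b c ab ac cb x with transposition-view a c x
  ... | inj₁ (p , e) rewrite p | e =
    trans (transposition-left a b)
          (sym (trans (cong (transposition a c) (transposition-left c b)) (transposition-fixes a c b (ab ∘ sym) (cb ∘ sym))))
  ... | inj₂ (inj₁ ((p , q) , e)) =
    trans (cong (transposition a b) q)
      (trans (transposition-fixes a b c (ac ∘ sym) cb)
        (sym (trans (cong (transposition a c ∘ transposition c b) e)
                    (trans (cong (transposition a c) (transposition-fixes c b a ac ab)) (transposition-left a c)))))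
  ... | inj₂ (inj₂ ((p , q) , e)) with transposition-view c b x
  ...   | inj₁ (p' , _) = ⊥-elim (q p')
  ...   | inj₂ (inj₁ ((_ , q') , e')) =
    trans (cong (transposition a b) q')
      (trans (transposition-right a b)
        (sym (trans (cong (transposition a c ∘ transposition c b) e) (trans (cong (transposition a c) e') (transposition-right a c)))))
  ...   | inj₂ (inj₂ ((p' , q') , e')) =
    trans (transposition-fixes a b x p q')
      (sym (trans (cong (transposition a c ∘ transposition c b) e) (trans (cong (transposition a c) e') e)))

private
  no-between : ∀ {A x : ℕ} → A ℕ.< x → x ℕ.< suc A → ⊥
  no-between p q = ℕP.<⇒≱ p (ℕ.s≤s⁻¹ q)

adjacent-inversion : ∀ {n} (a b : Fin n) → toℕ b ≡ suc (toℕ a) → ∀ (i j : Fin n) →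
  (i F.< j × transposition a b j F.< transposition a b i) → (i ≡ a × j ≡ b)
adjacent-inversion a b hb i j (h1 , h2) with transposition-view a b i | transposition-view a b j
... | inj₁ (ia , _) | inj₁ (ja , _) = ⊥-elim (FP.<⇒≢ h1 (trans ia (sym ja)))
... | inj₁ (ia , _) | inj₂ (inj₁ ((_ , jb) , _)) = ia , jb
... | inj₁ (ia , ei) | inj₂ (inj₂ (_ , ej)) =
  ⊥-elim (no-between (subst (λ z → toℕ z ℕ.< toℕ j) ia h1) (subst (toℕ j ℕ.<_) hb (subst₂ F._<_ ej ei h2)))
... | inj₂ (inj₁ (_ , ei)) | inj₁ (_ , ej) =
  ⊥-elim (ℕP.<⇒≱ (subst (ℕ._< toℕ a) hb (subst₂ F._<_ ej ei h2)) (ℕP.n≤1+n (toℕ a)))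
... | inj₂ (inj₁ ((_ , ib) , _)) | inj₂ (inj₁ ((_ , jb) , _)) = ⊥-elim (FP.<⇒≢ h1 (trans ib (sym jb)))
... | inj₂ (inj₁ ((_ , ib) , ei)) | inj₂ (inj₂ (_ , ej)) =
  ⊥-elim (ℕP.<-asym (subst₂ F._<_ ej ei h2) (ℕP.<-trans (ℕP.n<1+n (toℕ a)) (subst (ℕ._< toℕ j) hb (subst (λ w → toℕ w ℕ.< toℕ j) ib h1))))
... | inj₂ (inj₂ (_ , ei)) | inj₁ (ja , ej) =
  ⊥-elim (ℕP.<-asym (subst (λ z → toℕ i ℕ.< toℕ z) ja h1) (ℕP.<-trans (ℕP.n<1+n (toℕ a)) (subst (ℕ._< toℕ i) hb (subst₂ F._<_ ej ei h2))))
... | inj₂ (inj₂ (_ , ei)) | inj₂ (inj₁ ((_ , jb) , ej)) =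
  ⊥-elim (no-between (subst₂ F._<_ ej ei h2) (subst (toℕ i ℕ.<_) hb (subst (λ z → toℕ i ℕ.< toℕ z) jb h1)))
... | inj₂ (inj₂ (_ , ei)) | inj₂ (inj₂ (_ , ej)) = ⊥-elim (ℕP.<-asym h1 (subst₂ F._<_ ej ei h2))

sign-adjacent : ∀ {n} (a b : Fin n) → toℕ b ≡ suc (toℕ a) → sign (transposition a b) ≡ -1ℤ
sign-adjacent {n} a b hb = cong (-1ℤ ℤ.^_) (+-injective (begin
    ℤ.+ inversions t
      ≡⟨ inversions-Σ< t ⟩
    Σ< (λ i j → lt (t j) (t i))
      ≡⟨ ΣF-cong (λ i → ΣF-cong λ j →
           trans (sym (⟦⟧-× (i <? j) (t j <? t i)))
                 (trans (⟦⟧-cong (adjacent-inversion a b hb i j) only-pair _ ((i ≟ a) ×-dec (j ≟ b))) (⟦⟧-× (i ≟ a) (j ≟ b)))) ⟩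
    ΣF (λ i → ΣF (λ j → ⟦ i ≟ a ⟧ * ⟦ j ≟ b ⟧))
      ≡⟨ ΣF-cong (λ i → trans (ΣL-* (allFin n) ⟦ i ≟ a ⟧ _) (trans (cong (⟦ i ≟ a ⟧ *_) (count b)) (*-identityʳ _))) ⟩
    ΣF (λ i → ⟦ i ≟ a ⟧)
      ≡⟨ count a ⟩
    1ℤ ∎))
  where
  open ≡-Reasoning
  open Reindexing (fin-enumeration n) using (count)
  t : Perm n
  t = transposition a b
  a<b : a F.< b
  a<b = subst (toℕ a ℕ.<_) (sym hb) (ℕP.n<1+n _)
  only-pair : ∀ {i j} → (i ≡ a × j ≡ b) → (i F.< j × t j F.< t i)
  only-pair (refl , refl) = a<b , subst₂ F._<_ (sym (transposition-right a b)) (sym (transposition-left a b)) a<b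

-- A transposition (a b) with b = a + d + 1 is odd, by induction on d,
-- conjugating by the adjacent transposition (a a+1).
sign-transposition-at-distance : ∀ {n} d (a b : Fin n) → toℕ b ≡ suc (d ℕ.+ toℕ a) → sign (transposition a b) ≡ -1ℤ
sign-transposition-at-distance zero a b hb = sign-adjacent a b hb
sign-transposition-at-distance {n} (suc d) a b hb = begin
    sign (transposition a b)
      ≡⟨ sign-cong (transposition-conjugate a b c ab ac cb) ⟩
    sign (tac ∘ tcb ∘ tac)
      ≡⟨ sign-∘ tac (tcb ∘ tac) (transposition-IsPerm a c) (∘-IsPerm tcb tac (transposition-IsPerm c b) (transposition-IsPerm a c)) ⟩
    sign tac * sign (tcb ∘ tac)
      ≡⟨ cong (sign tac *_) (sign-∘ tcb tac (transposition-IsPerm c b) (transposition-IsPerm a c)) ⟩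
    sign tac * (sign tcb * sign tac)
      ≡⟨ cong₂ (λ u v → u * (v * u)) (sign-adjacent a c hc) (sign-transposition-at-distance d c b hcb) ⟩
    -1ℤ ∎
  where
  open ≡-Reasoning
  c<n : suc (toℕ a) ℕ.< n
  c<n = ℕP.<-trans (subst (suc (toℕ a) ℕ.<_) (sym hb) (ℕ.s≤s (ℕ.s≤s (ℕP.m≤n+m (toℕ a) d)))) (FP.toℕ<n b)
  c : Fin n
  c = F.fromℕ< c<n
  hc : toℕ c ≡ suc (toℕ a)
  hc = FP.toℕ-fromℕ< c<n
  hcb : toℕ b ≡ suc (d ℕ.+ toℕ c)
  hcb = trans hb (cong suc (trans (sym (ℕP.+-suc d (toℕ a))) (cong (d ℕ.+_) (sym hc))))
  tac tcb : Perm n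
  tac = transposition a c
  tcb = transposition c b
  ab : a ≢ b
  ab e = ℕP.<-irrefl (cong toℕ e) (subst (toℕ a ℕ.<_) (sym hb) (ℕ.s≤s (ℕP.m≤n+m (toℕ a) (suc d))))
  ac : a ≢ c
  ac e = ℕP.<-irrefl (cong toℕ e) (subst (toℕ a ℕ.<_) (sym hc) (ℕP.n<1+n _))
  cb : c ≢ b
  cb e = ℕP.<-irrefl (cong toℕ e) (subst (toℕ c ℕ.<_) (sym hcb) (ℕ.s≤s (ℕP.m≤n+m (toℕ c) d)))

sign-transposition : ∀ {n} (a b : Fin n) → a ≢ b → sign (transposition a b) ≡ -1ℤ
sign-transposition a b ne with <-cmp a b
... | tri≈ _ e _ = ⊥-elim (ne e)
... | tri< a<b _ _ = sign-transposition-at-distance (toℕ b ℕ.∸ suc (toℕ a)) a b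
        (trans (sym (ℕP.m∸n+n≡m a<b)) (ℕP.+-suc (toℕ b ℕ.∸ suc (toℕ a)) (toℕ a)))
... | tri> _ _ b<a = trans (sign-cong (transposition-comm a b)) (sign-transposition-at-distance (toℕ a ℕ.∸ suc (toℕ b)) b a
        (trans (sym (ℕP.m∸n+n≡m b<a)) (ℕP.+-suc (toℕ a ℕ.∸ suc (toℕ b)) (toℕ b))))

sign-conjugate : ∀ {n} (t σ : Perm n) → IsPerm t → IsPerm σ → sign (t ∘ σ ∘ t) ≡ sign σ
sign-conjugate t σ it iσ = begin
    sign (t ∘ σ ∘ t) ≡⟨ sign-∘ t (σ ∘ t) it (∘-IsPerm σ t iσ it) ⟩
    sign t * sign (σ ∘ t) ≡⟨ cong (sign t *_) (sign-∘ σ t iσ it) ⟩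
    sign t * (sign σ * sign t) ≡⟨ rearrange (sign t) (sign σ) ⟩
    sign σ * (sign t * sign t) ≡⟨ trans (cong (sign σ *_) (sign-square t)) (*-identityʳ (sign σ)) ⟩
    sign σ ∎
  where
  open ≡-Reasoning
  rearrange : ∀ (u s : ℤ) → u * (s * u) ≡ s * (u * u)
  rearrange = solve-∀

sign-transposition-∘ : ∀ {n} (a b : Fin n) → a ≢ b → (σ : Perm n) → IsPerm σ →
  sign (transposition a b ∘ σ) ≡ - sign σ
sign-transposition-∘ a b ne σ iσ = begin
    sign (transposition a b ∘ σ) ≡⟨ sign-∘ (transposition a b) σ (transposition-IsPerm a b) iσ ⟩
    sign (transposition a b) * sign σ ≡⟨ cong (_* sign σ) (sign-transposition a b ne) ⟩
    -1ℤ * sign σ ≡⟨ -1*i≡-i (sign σ) ⟩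
    - sign σ ∎
  where open ≡-Reasoning

δ : ∀ {n} → Perm n → Perm n → ℤ
δ σ g = ⟦ σ ≐? g ⟧

δ-cong : ∀ {n} {σ σ' g g' : Perm n} → σ ≐ σ' → g ≐ g' → δ σ g ≡ δ σ' g'
δ-cong e₁ e₂ = ⟦⟧-cong (λ h i → trans (sym (e₁ i)) (trans (h i) (e₂ i))) (λ h i → trans (e₁ i) (trans (h i) (sym (e₂ i)))) _ _

δ-involution : ∀ {n} (t : Perm n) → (∀ x → t (t x) ≡ x) → (α h : Perm n) → δ (t ∘ α) h ≡ δ α (t ∘ h)
δ-involution t tt α h = ⟦⟧-cong (λ q i → trans (sym (tt (α i))) (cong t (q i))) (λ q i → trans (cong t (q i)) (tt (h i))) _ _

coeff-ΣL : ∀ {n} (x : GA n) g → coeff x g ≡ ΣL x (λ p → proj₁ p * δ (proj₂ p) g)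
coeff-ΣL [] g = refl
coeff-ΣL ((c , σ) ∷ x) g with all? (λ i → σ i ≟ g i)
... | yes _ = cong₂ _+_ (sym (*-identityʳ c)) (coeff-ΣL x g)
... | no _ = trans (coeff-ΣL x g) (sym (trans (cong (_+ ΣL x (λ p → proj₁ p * δ (proj₂ p) g)) (*-zeroʳ c)) (+-identityˡ _)))

coeff-⊛ : ∀ {n} (x y : GA n) g → coeff (x ⊛ y) g ≡
  ΣL x (λ p → ΣL y (λ q → (proj₁ p * proj₁ q) * δ (proj₂ p ∘ proj₂ q) g))
coeff-⊛ x y g = trans (coeff-ΣL (x ⊛ y) g) (trans (ΣL-concatMap _ x _) (ΣL-cong x (λ p → ΣL-map _ y _)))

coeff-concatMap : ∀ {n} {A : Set} (F : A → GA n) (L : List A) g → coeff (concatMap F L) g ≡ ΣL L (λ a → coeff (F a) g)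
coeff-concatMap F L g =
  trans (coeff-ΣL (concatMap F L) g) (trans (ΣL-concatMap F L _) (ΣL-cong L (λ a → sym (coeff-ΣL (F a) g))))

coeff-⊛-involution : ∀ {n} (x : GA n) (t : Perm n) → (∀ i → t (t i) ≡ i) → ∀ g → coeff (x ⊛ basis t) g ≡ coeff x (g ∘ t)
coeff-⊛-involution x t tt g = begin
    coeff (x ⊛ basis t) g
      ≡⟨ coeff-⊛ x (basis t) g ⟩
    ΣL x (λ p → (proj₁ p * 1ℤ) * δ (proj₂ p ∘ t) g + 0ℤ)
      ≡⟨ ΣL-cong x (λ p → trans (+-identityʳ _) (cong₂ _*_ (*-identityʳ (proj₁ p)) (move p))) ⟩
    ΣL x (λ p → proj₁ p * δ (proj₂ p) (g ∘ t))
      ≡⟨ sym (coeff-ΣL x (g ∘ t)) ⟩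
    coeff x (g ∘ t) ∎
  where
  open ≡-Reasoning
  move : ∀ p → δ (proj₂ p ∘ t) g ≡ δ (proj₂ p) (g ∘ t)
  move p = ⟦⟧-cong (λ h i → trans (cong (proj₂ p) (sym (tt i))) (h (t i))) (λ h i → trans (h (t i)) (cong g (tt i))) _ _

Pos : ℕ → Set
Pos n = Fin n → ℕ × ℕ

rowPreserving? : ∀ {n} (pos : Pos n) (σ : Perm n) → Dec (∀ i → proj₁ (pos (σ i)) ≡ proj₁ (pos i))
rowPreserving? pos σ = all? (λ i → proj₁ (pos (σ i)) ℕ.≟ proj₁ (pos i))

colPreserving? : ∀ {n} (pos : Pos n) (σ : Perm n) → Dec (∀ i → proj₂ (pos (σ i)) ≡ proj₂ (pos i))
colPreserving? pos σ = all? (λ i → proj₂ (pos (σ i)) ℕ.≟ proj₂ (pos i))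

rowCoeff : ∀ {n} → Pos n → Perm n → ℤ
rowCoeff pos σ = ⟦ isPerm? σ ⟧ * (⟦ rowPreserving? pos σ ⟧ * sign σ)

colCoeff : ∀ {n} → Pos n → Perm n → ℤ
colCoeff pos τ = ⟦ isPerm? τ ⟧ * ⟦ colPreserving? pos τ ⟧

youngCoeff : ∀ {n} → Pos n → Perm n → ℤ
youngCoeff pos g = ΣP (λ σ → ΣP (λ τ → rowCoeff pos σ * (colCoeff pos τ * δ (σ ∘ τ) g)))

coeff-youngSym : ∀ {n} (pos : Pos n) g → coeff (youngSym pos) g ≡ youngCoeff pos g
coeff-youngSym {n} pos g = begin
    coeff (youngSym pos) g
      ≡⟨ coeff-⊛ (map (λ σ → sign σ , σ) (rowGroup pos)) (map (λ τ → 1ℤ , τ) (colGroup pos)) g ⟩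
    ΣL (map (λ σ → sign σ , σ) (rowGroup pos)) (λ p → ΣL (map (λ τ → 1ℤ , τ) (colGroup pos)) (λ q → (proj₁ p * proj₁ q) * δ (proj₂ p ∘ proj₂ q) g))
      ≡⟨ trans (ΣL-map _ (rowGroup pos) _) (ΣL-cong (rowGroup pos) (λ σ → ΣL-map _ (colGroup pos) _)) ⟩
    ΣL (rowGroup pos) (λ σ → ΣL (colGroup pos) (λ τ → term σ τ))
      ≡⟨ trans (ΣL-filter (rowPreserving? pos) (allPerms n) _) (ΣL-filter isPerm? (allFuns n) _) ⟩
    ΣP (λ σ → ⟦ isPerm? σ ⟧ * (⟦ rowPreserving? pos σ ⟧ * ΣL (colGroup pos) (λ τ → term σ τ)))
      ≡⟨ ΣP-cong (λ σ → cong (λ z → ⟦ isPerm? σ ⟧ * (⟦ rowPreserving? pos σ ⟧ * z))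
           (trans (ΣL-filter (colPreserving? pos) (allPerms n) _) (ΣL-filter isPerm? (allFuns n) _))) ⟩
    ΣP (λ σ → ⟦ isPerm? σ ⟧ * (⟦ rowPreserving? pos σ ⟧ * ΣP (colTerm σ)))
      ≡⟨ ΣP-cong (λ σ → trans (cong (⟦ isPerm? σ ⟧ *_) (sym (ΣL-* (allFuns n) ⟦ rowPreserving? pos σ ⟧ (colTerm σ))))
                              (sym (ΣL-* (allFuns n) ⟦ isPerm? σ ⟧ (λ τ → ⟦ rowPreserving? pos σ ⟧ * colTerm σ τ)))) ⟩
    ΣP (λ σ → ΣP (λ τ → ⟦ isPerm? σ ⟧ * (⟦ rowPreserving? pos σ ⟧ * colTerm σ τ)))
      ≡⟨ ΣP-cong (λ σ → ΣP-cong λ τ → rearrange ⟦ isPerm? σ ⟧ ⟦ rowPreserving? pos σ ⟧ ⟦ isPerm? τ ⟧ ⟦ colPreserving? pos τ ⟧ (sign σ) (δ (σ ∘ τ) g)) ⟩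
    youngCoeff pos g ∎
  where
  open ≡-Reasoning
  term : Perm n → Perm n → ℤ
  term σ τ = (sign σ * 1ℤ) * δ (σ ∘ τ) g
  colTerm : Perm n → Perm n → ℤ
  colTerm σ τ = ⟦ isPerm? τ ⟧ * (⟦ colPreserving? pos τ ⟧ * term σ τ)
  rearrange : ∀ (a b c d s z : ℤ) → a * (b * (c * (d * ((s * 1ℤ) * z)))) ≡ (a * (b * s)) * ((c * d) * z)
  rearrange = solve-∀

isPerm-cong : ∀ {n} {σ σ' : Perm n} → σ ≐ σ' → ⟦ isPerm? σ ⟧ ≡ ⟦ isPerm? σ' ⟧
isPerm-cong e = ⟦⟧-cong (λ p x y q → p x y (trans (e x) (trans q (sym (e y)))))
                        (λ p x y q → p x y (trans (sym (e x)) (trans q (e y)))) (isPerm? _) (isPerm? _)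

rowCoeff-cong : ∀ {n} (pos : Pos n) {σ σ' : Perm n} → σ ≐ σ' → rowCoeff pos σ ≡ rowCoeff pos σ'
rowCoeff-cong pos e = cong₂ _*_ (isPerm-cong e) (cong₂ _*_
  (⟦⟧-cong (λ p i → trans (cong (proj₁ ∘ pos) (sym (e i))) (p i)) (λ p i → trans (cong (proj₁ ∘ pos) (e i)) (p i))
           (rowPreserving? pos _) (rowPreserving? pos _))
  (sign-cong e))

colCoeff-cong : ∀ {n} (pos : Pos n) {σ σ' : Perm n} → σ ≐ σ' → colCoeff pos σ ≡ colCoeff pos σ'
colCoeff-cong pos e = cong₂ _*_ (isPerm-cong e)
  (⟦⟧-cong (λ p i → trans (cong (proj₂ ∘ pos) (sym (e i))) (p i)) (λ p i → trans (cong (proj₂ ∘ pos) (e i)) (p i))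
           (colPreserving? pos _) (colPreserving? pos _))

youngCoeff-cong : ∀ {n} (pos : Pos n) {h h' : Perm n} → h ≐ h' → youngCoeff pos h ≡ youngCoeff pos h'
youngCoeff-cong pos q = ΣP-cong λ σ → ΣP-cong λ τ →
  cong (λ z → rowCoeff pos σ * (colCoeff pos τ * z)) (δ-cong {σ = σ ∘ τ} (λ _ → refl) q)

module Conjugation {n : ℕ} (t : Perm n) (tt : ∀ x → t (t x) ≡ x) where

  conj : Perm n → Perm n
  conj σ = t ∘ σ ∘ t

  conj-cong : ∀ {σ σ'} → σ ≐ σ' → conj σ ≐ conj σ'
  conj-cong e x = cong t (e (t x))

  conj-involutive : ∀ σ → conj (conj σ) ≐ σ
  conj-involutive σ x = trans (tt _) (cong σ (tt x))

  isPerm-conj : ∀ σ → ⟦ isPerm? σ ⟧ ≡ ⟦ isPerm? (conj σ) ⟧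
  isPerm-conj σ = ⟦⟧-cong (λ p x y q → injective p x y q) (λ p x y q → reflect p x y q) _ _
    where
    injective : IsPerm σ → IsPerm (conj σ)
    injective p x y q = trans (sym (tt x)) (trans (cong t (p (t x) (t y) (trans (sym (tt _)) (trans (cong t q) (tt _))))) (tt y))
    reflect : IsPerm (conj σ) → IsPerm σ
    reflect p x y q = trans (sym (tt x)) (trans (cong t (p (t x) (t y)
                        (trans (cong (t ∘ σ) (tt x)) (trans (cong t q) (cong (t ∘ σ) (sym (tt y))))))) (tt y))

  preserves-conj : ∀ (c : ℕ × ℕ → ℕ) (pos : Pos n) σ →
    (∀ i → c (pos (t (σ i))) ≡ c (pos (t i))) → (∀ i → c (pos (conj σ i)) ≡ c (pos i))
  preserves-conj c pos σ q i = trans (q (t i)) (cong (c ∘ pos) (tt i))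

  preserves-conj⁻ : ∀ (c : ℕ × ℕ → ℕ) (pos : Pos n) σ →
    (∀ i → c (pos (conj σ i)) ≡ c (pos i)) → (∀ i → c (pos (t (σ i))) ≡ c (pos (t i)))
  preserves-conj⁻ c pos σ q i = trans (cong (c ∘ pos ∘ t ∘ σ) (sym (tt i))) (q (t i))

  rowCoeff-conj : ∀ (pos : Pos n) σ → rowCoeff (pos ∘ t) σ ≡ rowCoeff pos (conj σ)
  rowCoeff-conj pos σ with isPerm? σ | isPerm? (conj σ) | isPerm-conj σ
  ... | yes p | yes _ | _ = cong₂ (λ u v → 1ℤ * (u * v))
        (⟦⟧-cong (preserves-conj proj₁ pos σ) (preserves-conj⁻ proj₁ pos σ) (rowPreserving? (pos ∘ t) σ) (rowPreserving? pos (conj σ)))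
        (sym (sign-conjugate t σ (λ x y q → trans (sym (tt x)) (trans (cong t q) (tt y))) p))
  ... | yes _ | no _ | ()
  ... | no _ | yes _ | ()
  ... | no _ | no _ | _ = refl

  colCoeff-conj : ∀ (pos : Pos n) σ → colCoeff (pos ∘ t) σ ≡ colCoeff pos (conj σ)
  colCoeff-conj pos σ = cong₂ _*_ (isPerm-conj σ)
    (⟦⟧-cong (preserves-conj proj₂ pos σ) (preserves-conj⁻ proj₂ pos σ) (colPreserving? (pos ∘ t) σ) (colPreserving? pos (conj σ)))

  δ-conj : ∀ σ τ h → δ (σ ∘ τ) h ≡ δ (conj σ ∘ conj τ) (conj h)
  δ-conj σ τ h = ⟦⟧-cong (λ q i → cong t (trans (cong σ (tt _)) (q (t i))))
                         (λ q i → trans (sym (tt _)) (trans (cong t (trans (cong (t ∘ σ) (sym (trans (tt _) (cong τ (tt i)))))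
                                                                       (trans (q (t i)) (cong (t ∘ h) (tt i))))) (tt _))) _ _

  youngCoeff-conj : ∀ (pos : Pos n) h → youngCoeff (pos ∘ t) h ≡ youngCoeff pos (conj h)
  youngCoeff-conj pos h = begin
      youngCoeff (pos ∘ t) h
        ≡⟨ ΣP-cong (λ σ → ΣP-cong λ τ → cong₂ _*_ (rowCoeff-conj pos σ) (cong₂ _*_ (colCoeff-conj pos τ) (δ-conj σ τ h))) ⟩
      ΣP (λ σ → ΣP (λ τ → rowCoeff pos (conj σ) * (colCoeff pos (conj τ) * δ (conj σ ∘ conj τ) (conj h))))
        ≡⟨ ΣP-cong (λ σ → reindex conj conj-bijective (λ τ → rowCoeff pos (conj σ) * (colCoeff pos τ * δ (conj σ ∘ τ) (conj h)))
              (λ q → cong (rowCoeff pos (conj σ) *_) (cong₂ _*_ (colCoeff-cong pos q) (δ-cong (∘-cong {σ = conj σ} (λ _ → refl) q) (λ _ → refl))))) ⟩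
      ΣP (λ σ → ΣP (λ τ → rowCoeff pos (conj σ) * (colCoeff pos τ * δ (conj σ ∘ τ) (conj h))))
        ≡⟨ reindex conj conj-bijective (λ σ → ΣP (λ τ → rowCoeff pos σ * (colCoeff pos τ * δ (σ ∘ τ) (conj h))))
              (λ q → ΣP-cong (λ τ → cong₂ _*_ (rowCoeff-cong pos q) (cong (colCoeff pos τ *_) (δ-cong (∘-cong q (λ _ → refl)) (λ _ → refl))))) ⟩
      youngCoeff pos (conj h) ∎
    where
    open ≡-Reasoning
    open Reindexing (map-enumeration n) using (Bijective; reindex; involution-bijective)
    conj-bijective : Bijective conj
    conj-bijective = involution-bijective conj conj-cong conj-involutive

transposition-braid : ∀ {n} (e f f' : Fin n) → e ≢ f → e ≢ f' → f ≢ f' →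
  transposition f f' ∘ transposition e f' ≐ transposition e f' ∘ transposition e f
transposition-braid e f f' ef ef' ff' x with transposition-view e f' x
... | inj₁ (xe , ex) =
  trans (cong (transposition f f') ex)
    (trans (transposition-right f f')
      (sym (trans (cong (transposition e f' ∘ transposition e f) xe)
                  (trans (cong (transposition e f') (transposition-left e f)) (transposition-fixes e f' f (ef ∘ sym) ff')))))
... | inj₂ (inj₁ ((xne , xf') , ex)) =
  trans (cong (transposition f f') ex)
    (trans (transposition-fixes f f' e ef ef')
      (sym (trans (cong (transposition e f' ∘ transposition e f) xf')
                  (trans (cong (transposition e f') (transposition-fixes e f f' (ef' ∘ sym) (ff' ∘ sym))) (transposition-right e f')))))
... | inj₂ (inj₂ ((xne , xnf') , ex)) with transposition-view e f x
...   | inj₁ (xe , _) = ⊥-elim (xne xe)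
...   | inj₂ (inj₁ ((_ , xf) , _)) =
  trans (cong (transposition f f') ex)
    (trans (cong (transposition f f') xf)
      (trans (transposition-left f f')
        (sym (trans (cong (transposition e f' ∘ transposition e f) xf)
                    (trans (cong (transposition e f') (transposition-right e f)) (transposition-left e f'))))))
...   | inj₂ (inj₂ ((_ , xnf) , _)) =
  trans (cong (transposition f f') ex)
    (trans (transposition-fixes f f' x xnf xnf') (sym (trans (cong (transposition e f') (transposition-fixes e f x xne xnf)) ex)))

module Cancellation {n : ℕ} (S : Subset n) (pos : Pos n)
  (pos-injective : ∀ i j → pos i ≡ pos j → i ≡ j)
  (first-row : ∀ i → (proj₁ (pos i) ≡ 0 → i ∈ S) × (i ∈ S → proj₁ (pos i) ≡ 0))
  (e : Fin n) (e∉S : e ∉ S) (s₀ : Fin n) (s₀∈S : s₀ ∈ S) (s₀-column : proj₂ (pos s₀) ≡ 0)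
  (column-0 : ∀ i → proj₁ (pos i) ≢ 0 → proj₂ (pos i) ≡ 0) where

  row col : Fin n → ℕ
  row i = proj₁ (pos i)
  col i = proj₂ (pos i)

  RowPerm : Perm n → Set
  RowPerm σ = IsPerm σ × (∀ i → row (σ i) ≡ row i)

  rowCoeff-cases : ∀ σ → RowPerm σ ⊎ (rowCoeff pos σ ≡ 0ℤ)
  rowCoeff-cases σ with isPerm? σ | rowPreserving? pos σ
  ... | yes p | yes q = inj₁ (p , q)
  ... | yes _ | no _ = inj₂ refl
  ... | no _ | _ = inj₂ refl

  rowCoeff-RowPerm : ∀ {σ} → RowPerm σ → rowCoeff pos σ ≡ sign σ
  rowCoeff-RowPerm {σ} (p , q) rewrite ⟦⟧-yes p (isPerm? σ) | ⟦⟧-yes q (rowPreserving? pos σ) =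
    trans (*-identityˡ _) (*-identityˡ _)

  e-row : row e ≢ 0
  e-row r = e∉S (proj₁ (first-row e) r)

  e-column : col e ≡ 0
  e-column = column-0 e e-row

  -- e sits alone in its row, so row permutations fix it ...
  RowPerm-fixes-e : ∀ {σ} → RowPerm σ → σ e ≡ e
  RowPerm-fixes-e {σ} (p , q) =
    pos-injective (σ e) e (cong₂ _,_ (q e) (trans (column-0 (σ e) (λ z → e-row (trans (sym (q e)) z))) (sym e-column)))

  RowPerm-S : ∀ {σ} → RowPerm σ → ∀ {x} → x ∈ S → σ x ∈ S
  RowPerm-S (p , q) {x} x∈S = proj₁ (first-row _) (trans (q x) (proj₂ (first-row x) x∈S))

  transposition-S-row : ∀ {f f'} → f ∈ S → f' ∈ S → ∀ y → row (transposition f f' y) ≡ row y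
  transposition-S-row {f} {f'} f∈S f'∈S y with transposition-view f f' y
  ... | inj₁ (yf , ey) =
    trans (cong row ey) (trans (proj₂ (first-row f') f'∈S) (sym (trans (cong row yf) (proj₂ (first-row f) f∈S))))
  ... | inj₂ (inj₁ ((_ , yf') , ey)) =
    trans (cong row ey) (trans (proj₂ (first-row f) f∈S) (sym (trans (cong row yf') (proj₂ (first-row f') f'∈S))))
  ... | inj₂ (inj₂ (_ , ey)) = cong row ey

  u : Perm n
  u = transposition e s₀

  RowPerm-∘u : ∀ {σ} → RowPerm σ → σ ∘ u ≐ transposition e (σ s₀) ∘ σ
  RowPerm-∘u {σ} rp@(p , q) x with transposition-view e s₀ x
  ... | inj₁ (xe , ux) =
    trans (cong σ ux) (sym (trans (cong (transposition e (σ s₀) ∘ σ) xe)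
                                  (trans (cong (transposition e (σ s₀)) (RowPerm-fixes-e rp)) (transposition-left e (σ s₀)))))
  ... | inj₂ (inj₁ ((xne , xs) , ux)) =
    trans (cong σ ux) (trans (RowPerm-fixes-e rp) (sym (trans (cong (transposition e (σ s₀) ∘ σ) xs) (transposition-right e (σ s₀)))))
  ... | inj₂ (inj₂ ((xne , xns) , ux)) =
    trans (cong σ ux) (sym (transposition-fixes e (σ s₀) (σ x) (λ z → xne (p x e (trans z (sym (RowPerm-fixes-e rp))))) (λ z → xns (p x s₀ z))))

  -- u lies in the column group: e and s₀ are both in column 0.
  column-∘u : ∀ x → col (u x) ≡ col x
  column-∘u x with transposition-view e s₀ x
  ... | inj₁ (xe , ux) = trans (cong col ux) (trans s₀-column (sym (trans (cong col xe) e-column)))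
  ... | inj₂ (inj₁ ((_ , xs) , ux)) = trans (cong col ux) (trans e-column (sym (trans (cong col xs) s₀-column)))
  ... | inj₂ (inj₂ (_ , ux)) = cong col ux

  colCoeff-u∘ : ∀ τ → colCoeff pos (u ∘ τ) ≡ colCoeff pos τ
  colCoeff-u∘ τ = cong₂ _*_
    (⟦⟧-cong (λ p x y q → p x y (cong u q))
             (λ p x y q → p x y (trans (sym (transposition-involutive e s₀ _)) (trans (cong u q) (transposition-involutive e s₀ _))))
             (isPerm? (u ∘ τ)) (isPerm? τ))
    (⟦⟧-cong (λ p i → trans (sym (column-∘u (τ i))) (p i)) (λ p i → trans (column-∘u (τ i)) (p i))
             (colPreserving? pos (u ∘ τ)) (colPreserving? pos τ))

  -- The coefficient of h in R·τ, where R is the signed row sum.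
  rowSum : Perm n → Perm n → ℤ
  rowSum τ h = ΣP (λ σ → rowCoeff pos σ * δ (σ ∘ τ) h)

  rowSum-cong : ∀ {τ τ' h h'} → τ ≐ τ' → h ≐ h' → rowSum τ h ≡ rowSum τ' h'
  rowSum-cong q r = ΣP-cong (λ σ → cong (rowCoeff pos σ *_) (δ-cong (∘-cong {σ = σ} (λ _ → refl) q) r))

  youngCoeff-rowSum : ∀ (h : Perm n) → youngCoeff pos h ≡ ΣP (λ τ → colCoeff pos τ * rowSum τ h)
  youngCoeff-rowSum h =
    trans (ΣL-swap (allFuns n) (allFuns n) (λ σ τ → rowCoeff pos σ * (colCoeff pos τ * δ (σ ∘ τ) h)))
          (ΣP-cong (λ τ → trans (ΣP-cong (λ σ → exchange (rowCoeff pos σ) (colCoeff pos τ) (δ (σ ∘ τ) h)))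
                                (ΣL-* (allFuns n) (colCoeff pos τ) (λ σ → rowCoeff pos σ * δ (σ ∘ τ) h))))
    where
    exchange : ∀ (a b c : ℤ) → a * (b * c) ≡ b * (a * c)
    exchange = solve-∀

  rowSum-u∘ : ∀ (τ h : Perm n) → rowSum (u ∘ τ) h ≡ ΣP (λ σ → rowCoeff pos σ * δ (σ ∘ τ) (transposition e (σ s₀) ∘ h))
  rowSum-u∘ τ h = ΣP-cong λ σ → term σ (rowCoeff-cases σ)
    where
    term : ∀ (σ : Perm n) → RowPerm σ ⊎ (rowCoeff pos σ ≡ 0ℤ) →
      rowCoeff pos σ * δ (σ ∘ u ∘ τ) h ≡ rowCoeff pos σ * δ (σ ∘ τ) (transposition e (σ s₀) ∘ h)
    term σ (inj₁ rp) = cong (rowCoeff pos σ *_)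
      (trans (δ-cong (λ i → RowPerm-∘u rp (τ i)) (λ _ → refl))
             (δ-involution (transposition e (σ s₀)) (transposition-involutive e (σ s₀)) (σ ∘ τ) h))
    term σ (inj₂ z) = trans (cong (_* δ (σ ∘ u ∘ τ) h) z) (sym (cong (_* δ (σ ∘ τ) (transposition e (σ s₀) ∘ h)) z))

  -- Since σ s₀ ∈ S for σ ∈ R_T, the bracket [σs₀ ∈ S] is redundant next to rowCoeff σ.
  σs₀∈S-rowCoeff : ∀ (σ : Perm n) (X : ℤ) → ⟦ σ s₀ ∈? S ⟧ * (rowCoeff pos σ * X) ≡ rowCoeff pos σ * X
  σs₀∈S-rowCoeff σ X with rowCoeff-cases σ
  ... | inj₁ rp = trans (cong (_* (rowCoeff pos σ * X)) (⟦⟧-yes (RowPerm-S rp s₀∈S) (σ s₀ ∈? S))) (*-identityˡ _)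
  ... | inj₂ z = trans (cong (λ w → ⟦ σ s₀ ∈? S ⟧ * (w * X)) z) (trans (*-zeroʳ ⟦ σ s₀ ∈? S ⟧) (sym (cong (_* X) z)))

  Pair : Set
  Pair = Perm n × Fin n

  Pairable : Pair → Set
  Pairable (σ , f) = (f ∈ S) × (f ≢ σ s₀) × RowPerm σ

  pairable? : ∀ p → Dec (Pairable p)
  pairable? (σ , f) = (f ∈? S) ×-dec (¬? (f ≟ σ s₀) ×-dec (isPerm? σ ×-dec rowPreserving? pos σ))

  partner : Perm n → Fin n → Pair
  partner σ f = transposition f (σ s₀) ∘ σ , σ s₀

  pairing′ : ∀ p → Dec (Pairable p) → Pair
  pairing′ (σ , f) (yes _) = partner σ f
  pairing′ p (no _) = p

  pairing : Pair → Pair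
  pairing p = pairing′ p (pairable? p)

  pairing-yes : ∀ σ f → Pairable (σ , f) → pairing (σ , f) ≡ partner σ f
  pairing-yes σ f c with pairable? (σ , f)
  ... | yes _ = refl
  ... | no ¬c = ⊥-elim (¬c c)

  pairing-no : ∀ p → ¬ Pairable p → pairing p ≡ p
  pairing-no p ¬c with pairable? p
  ... | yes c = ⊥-elim (¬c c)
  ... | no _ = refl

  partner-Pairable : ∀ σ f → Pairable (σ , f) → Pairable (partner σ f)
  partner-Pairable σ f (f∈S , f≢σs₀ , ip , rp) =
    RowPerm-S (ip , rp) s₀∈S ,
    (λ z → f≢σs₀ (sym (trans z (transposition-right f (σ s₀))))) ,
    ∘-IsPerm (transposition f (σ s₀)) σ (transposition-IsPerm f (σ s₀)) ip ,
    (λ i → trans (transposition-S-row f∈S (RowPerm-S (ip , rp) s₀∈S) (σ i)) (rp i))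

  Pairable-cong : ∀ {σ σ' f} → σ ≐ σ' → Pairable (σ , f) → Pairable (σ' , f)
  Pairable-cong e₁ (f∈S , f≢σs₀ , ip , rp) =
    f∈S , (λ z → f≢σs₀ (trans z (sym (e₁ s₀)))) ,
    (λ x y q → ip x y (trans (e₁ x) (trans q (sym (e₁ y))))) , (λ i → trans (cong (proj₁ ∘ pos) (sym (e₁ i))) (rp i))

  pair-enumeration : Enumeration Pair
  pair-enumeration = product-enumeration (map-enumeration n) (fin-enumeration n)

  Σₚ : (Pair → ℤ) → ℤ
  Σₚ = ΣL (pairs (allFuns n) (allFin n))

  open Enumeration pair-enumeration using (_~_; ~refl)
  open Reindexing pair-enumeration using (reindex; involution-bijective)

  partner-involutive : ∀ σ f → Pairable (σ , f) → partner (proj₁ (partner σ f)) (proj₂ (partner σ f)) ~ (σ , f)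
  partner-involutive σ f c =
    (λ x → trans (cong (λ z → transposition (σ s₀) z (transposition f (σ s₀) (σ x))) back)
                 (trans (transposition-comm (σ s₀) f (transposition f (σ s₀) (σ x))) (transposition-involutive f (σ s₀) (σ x)))) ,
    back
    where
    back : transposition f (σ s₀) (σ s₀) ≡ f
    back = transposition-right f (σ s₀)

  pairing-involutive : ∀ p → pairing (pairing p) ~ p
  pairing-involutive (σ , f) with pairable? (σ , f)
  ... | yes c = subst (_~ (σ , f)) (sym (pairing-yes _ _ (partner-Pairable σ f c))) (partner-involutive σ f c)
  ... | no ¬c = subst (_~ (σ , f)) (sym (pairing-no (σ , f) ¬c)) ~refl

  pairing-cong : ∀ {p q} → p ~ q → pairing p ~ pairing q
  pairing-cong {σ , f} {σ' , .f} (e₁ , refl) with pairable? (σ , f)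
  ... | yes c = subst (partner σ f ~_) (sym (pairing-yes σ' f (Pairable-cong e₁ c)))
                      ((λ x → cong₂ (transposition f) (e₁ s₀) (e₁ x)) , e₁ s₀)
  ... | no ¬c = subst ((σ , f) ~_) (sym (pairing-no (σ' , f) (λ c → ¬c (Pairable-cong (λ i → sym (e₁ i)) c)))) (e₁ , refl)

  -- The coefficient of g in (1 - Σ_{f∈S} (e f)) R τ.
  defect : Perm n → Perm n → ℤ
  defect g τ = rowSum τ g - ΣF (λ f → ⟦ f ∈? S ⟧ * rowSum τ (transposition e f ∘ g))

  defect-cong : ∀ g {τ τ'} → τ ≐ τ' → defect g τ ≡ defect g τ'
  defect-cong g q = cong₂ _-_ (rowSum-cong q (λ _ → refl)) (ΣF-cong (λ f → cong (⟦ f ∈? S ⟧ *_) (rowSum-cong q (λ _ → refl))))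

  module Antisymmetry (τ g : Perm n) where

    term term-u : Perm n → Fin n → ℤ
    term σ f = ⟦ f ∈? S ⟧ * (rowCoeff pos σ * δ (σ ∘ τ) (transposition e f ∘ g))
    term-u σ f = ⟦ f ∈? S ⟧ * (rowCoeff pos σ * δ (σ ∘ τ) (transposition e (σ s₀) ∘ transposition e f ∘ g))

    diagonal diagonal-u : Perm n → ℤ
    diagonal σ = rowCoeff pos σ * δ (σ ∘ τ) (transposition e (σ s₀) ∘ g)
    diagonal-u σ = rowCoeff pos σ * δ (σ ∘ τ) g

    off : Perm n → Fin n → ℤ
    off σ f = ⟦ ¬? (f ≟ σ s₀) ⟧

    offDiagonal offDiagonal-u : Pair → ℤ
    offDiagonal (σ , f) = off σ f * term σ f
    offDiagonal-u (σ , f) = off σ f * term-u σ f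

    split-diagonal : ∀ (Q : Perm n → Fin n → ℤ) (K : Fin n → Perm n → ℤ) → (∀ σ f → ⟦ f ∈? S ⟧ * K f σ ≡ Q σ f) →
      ΣF (λ f → ⟦ f ∈? S ⟧ * ΣP (K f)) ≡ ΣP (λ σ → Q σ (σ s₀)) + ΣP (λ σ → ΣF (λ f → off σ f * Q σ f))
    split-diagonal Q K hQ = begin
        ΣF (λ f → ⟦ f ∈? S ⟧ * ΣP (K f))
          ≡⟨ ΣF-cong (λ f → trans (sym (ΣL-* (allFuns n) ⟦ f ∈? S ⟧ (K f))) (ΣP-cong (λ σ → hQ σ f))) ⟩
        ΣF (λ f → ΣP (λ σ → Q σ f))
          ≡⟨ ΣL-swap (allFin n) (allFuns n) (λ f σ → Q σ f) ⟩
        ΣP (λ σ → ΣF (λ f → Q σ f))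
          ≡⟨ ΣP-cong (λ σ → ΣF-split (σ s₀) (Q σ)) ⟩
        ΣP (λ σ → Q σ (σ s₀) + ΣF (λ f → off σ f * Q σ f))
          ≡⟨ ΣL-+ (allFuns n) (λ σ → Q σ (σ s₀)) (λ σ → ΣF (λ f → off σ f * Q σ f)) ⟩
        ΣP (λ σ → Q σ (σ s₀)) + ΣP (λ σ → ΣF (λ f → off σ f * Q σ f)) ∎
      where open ≡-Reasoning

    ΣS-rowSum : ΣF (λ f → ⟦ f ∈? S ⟧ * rowSum τ (transposition e f ∘ g)) ≡ ΣP diagonal + Σₚ offDiagonal
    ΣS-rowSum = trans (split-diagonal term (λ f σ → rowCoeff pos σ * δ (σ ∘ τ) (transposition e f ∘ g)) (λ σ f → refl))
                      (cong₂ _+_ (ΣP-cong (λ σ → σs₀∈S-rowCoeff σ _)) (sym (ΣL-pairs (allFuns n) (allFin n) offDiagonal)))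

    ΣS-rowSum-u : ΣF (λ f → ⟦ f ∈? S ⟧ * rowSum (u ∘ τ) (transposition e f ∘ g)) ≡ ΣP diagonal-u + Σₚ offDiagonal-u
    ΣS-rowSum-u = begin
        ΣF (λ f → ⟦ f ∈? S ⟧ * rowSum (u ∘ τ) (transposition e f ∘ g))
          ≡⟨ ΣF-cong (λ f → cong (⟦ f ∈? S ⟧ *_) (rowSum-u∘ τ (transposition e f ∘ g))) ⟩
        ΣF (λ f → ⟦ f ∈? S ⟧ * ΣP (λ σ → rowCoeff pos σ * δ (σ ∘ τ) (transposition e (σ s₀) ∘ transposition e f ∘ g)))
          ≡⟨ split-diagonal term-u (λ f σ → rowCoeff pos σ * δ (σ ∘ τ) (transposition e (σ s₀) ∘ transposition e f ∘ g)) (λ σ f → refl) ⟩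
        ΣP (λ σ → term-u σ (σ s₀)) + ΣP (λ σ → ΣF (λ f → off σ f * term-u σ f))
          ≡⟨ cong₂ _+_ (ΣP-cong (λ σ → trans (σs₀∈S-rowCoeff σ _) (cong (rowCoeff pos σ *_) (δ-cong {σ = σ ∘ τ} (λ _ → refl)
                          (λ i → transposition-involutive e (σ s₀) (g i))))))
                       (sym (ΣL-pairs (allFuns n) (allFin n) offDiagonal-u)) ⟩
        ΣP diagonal-u + Σₚ offDiagonal-u ∎
      where open ≡-Reasoning

    offDiagonal-cong : ∀ {p q} → p ~ q → offDiagonal p ≡ offDiagonal q
    offDiagonal-cong {σ , f} {σ' , .f} (e₁ , refl) = cong₂ _*_
      (⟦⟧-cong (λ z w → z (trans w (sym (e₁ s₀)))) (λ z w → z (trans w (e₁ s₀))) (¬? (f ≟ σ s₀)) (¬? (f ≟ σ' s₀)))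
      (cong (⟦ f ∈? S ⟧ *_) (cong₂ _*_ (rowCoeff-cong pos e₁) (δ-cong (∘-cong e₁ (λ _ → refl)) (λ _ → refl))))

    -- Paired terms cancel: with f' = σs₀, the partner of (σ, f) carries the
    -- sign of (f f') σ, i.e. the opposite one, and (f f')(e f') = (e f')(e f).
    offDiagonal-pairing : ∀ p → offDiagonal (pairing p) ≡ - offDiagonal-u p
    offDiagonal-pairing (σ , f) with pairable? (σ , f)
    ... | no ¬c = vanishing (¬? (f ≟ σ s₀)) (f ∈? S) (isPerm? σ) (rowPreserving? pos σ) ¬c
      where
      vanishing : (d₁ : Dec (f ≢ σ s₀)) (d₂ : Dec (f ∈ S)) (d₃ : Dec (IsPerm σ))
        (d₄ : Dec (∀ i → row (σ i) ≡ row i)) → ¬ Pairable (σ , f) →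
        ⟦ d₁ ⟧ * (⟦ d₂ ⟧ * ((⟦ d₃ ⟧ * (⟦ d₄ ⟧ * sign σ)) * δ (σ ∘ τ) (transposition e f ∘ g))) ≡
        - (⟦ d₁ ⟧ * (⟦ d₂ ⟧ * ((⟦ d₃ ⟧ * (⟦ d₄ ⟧ * sign σ)) * δ (σ ∘ τ) (transposition e (σ s₀) ∘ transposition e f ∘ g))))
      vanishing (yes a) (yes b) (yes c) (yes d) ¬c = ⊥-elim (¬c (b , a , c , d))
      vanishing (no _) _ _ _ _ = refl
      vanishing (yes _) (no _) _ _ _ = refl
      vanishing (yes _) (yes _) (no _) _ _ = refl
      vanishing (yes _) (yes _) (yes _) (no _) _ = refl
    ... | yes c@(f∈S , f≢f' , rp) = begin
        offDiagonal (partner σ f)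
          ≡⟨ cong₂ _*_ (⟦⟧-yes (proj₁ (proj₂ c')) (¬? (f' ≟ σ' s₀)))
               (cong₂ _*_ (⟦⟧-yes (proj₁ c') (f' ∈? S))
                 (cong₂ _*_ (trans (rowCoeff-RowPerm (proj₂ (proj₂ c'))) (sign-transposition-∘ f f' f≢f' σ (proj₁ rp)))
                            (trans (δ-involution (transposition f f') (transposition-involutive f f') (σ ∘ τ) (transposition e f' ∘ g))
                                   (δ-cong {σ = σ ∘ τ} (λ _ → refl) (transposition-braid e f f' e≢f e≢f' f≢f' ∘ g))))) ⟩
        1ℤ * (1ℤ * (- sign σ * δ (σ ∘ τ) (transposition e f' ∘ transposition e f ∘ g)))
          ≡⟨ pull-out-sign (sign σ) _ ⟩
        - (1ℤ * (1ℤ * (sign σ * δ (σ ∘ τ) (transposition e f' ∘ transposition e f ∘ g))))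
          ≡⟨ cong -_ (sym (cong₂ _*_ (⟦⟧-yes f≢f' (¬? (f ≟ σ s₀)))
               (cong₂ _*_ (⟦⟧-yes f∈S (f ∈? S)) (cong (_* δ (σ ∘ τ) (transposition e f' ∘ transposition e f ∘ g)) (rowCoeff-RowPerm rp))))) ⟩
        - offDiagonal-u (σ , f) ∎
      where
      open ≡-Reasoning
      f' : Fin n
      f' = σ s₀
      σ' : Perm n
      σ' = transposition f f' ∘ σ
      c' : Pairable (partner σ f)
      c' = partner-Pairable σ f c
      e≢f : e ≢ f
      e≢f refl = e∉S f∈S
      e≢f' : e ≢ f'
      e≢f' z = e∉S (subst (_∈ S) (sym z) (RowPerm-S rp s₀∈S))
      pull-out-sign : ∀ (s X : ℤ) → 1ℤ * (1ℤ * (- s * X)) ≡ - (1ℤ * (1ℤ * (s * X)))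
      pull-out-sign = solve-∀

    offDiagonal-cancel : Σₚ offDiagonal ≡ - Σₚ offDiagonal-u
    offDiagonal-cancel = begin
        Σₚ offDiagonal
          ≡⟨ sym (reindex pairing (involution-bijective pairing pairing-cong pairing-involutive) offDiagonal offDiagonal-cong) ⟩
        Σₚ (offDiagonal ∘ pairing)
          ≡⟨ ΣL-cong (pairs (allFuns n) (allFin n)) offDiagonal-pairing ⟩
        Σₚ (λ p → - offDiagonal-u p)
          ≡⟨ ΣL-neg (pairs (allFuns n) (allFin n)) offDiagonal-u ⟩
        - Σₚ offDiagonal-u ∎
      where open ≡-Reasoning

    defect-u∘ : defect g (u ∘ τ) ≡ - defect g τ
    defect-u∘ = begin
        defect g (u ∘ τ)
          ≡⟨ cong₂ _-_ (rowSum-u∘ τ g) ΣS-rowSum-u ⟩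
        ΣP diagonal - (ΣP diagonal-u + Σₚ offDiagonal-u)
          ≡⟨ rearrange (ΣP diagonal) (ΣP diagonal-u) (Σₚ offDiagonal-u) ⟩
        - (ΣP diagonal-u - (ΣP diagonal + - Σₚ offDiagonal-u))
          ≡⟨ cong (λ z → - (ΣP diagonal-u - (ΣP diagonal + z))) (sym offDiagonal-cancel) ⟩
        - (ΣP diagonal-u - (ΣP diagonal + Σₚ offDiagonal))
          ≡⟨ cong (λ z → - (ΣP diagonal-u - z)) (sym ΣS-rowSum) ⟩
        - defect g τ ∎
      where
      open ≡-Reasoning
      rearrange : ∀ (a b r : ℤ) → a - (b + r) ≡ - (b - (a + - r))
      rearrange = solve-∀

  ΣS-youngCoeff : ∀ (g : Perm n) → ΣF (λ f → ⟦ f ∈? S ⟧ * youngCoeff pos (transposition e f ∘ g)) ≡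
    ΣP (λ τ → colCoeff pos τ * ΣF (λ f → ⟦ f ∈? S ⟧ * rowSum τ (transposition e f ∘ g)))
  ΣS-youngCoeff g = begin
      ΣF (λ f → ⟦ f ∈? S ⟧ * youngCoeff pos (eg f))
        ≡⟨ ΣF-cong (λ f → trans (cong (⟦ f ∈? S ⟧ *_) (youngCoeff-rowSum (eg f)))
             (sym (ΣL-* (allFuns n) ⟦ f ∈? S ⟧ (λ τ → colCoeff pos τ * rowSum τ (eg f))))) ⟩
      ΣF (λ f → ΣP (λ τ → ⟦ f ∈? S ⟧ * (colCoeff pos τ * rowSum τ (eg f))))
        ≡⟨ ΣL-swap (allFin n) (allFuns n) (λ f τ → ⟦ f ∈? S ⟧ * (colCoeff pos τ * rowSum τ (eg f))) ⟩
      ΣP (λ τ → ΣF (λ f → ⟦ f ∈? S ⟧ * (colCoeff pos τ * rowSum τ (eg f))))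
        ≡⟨ ΣP-cong (λ τ → trans (ΣF-cong (λ f → exchange ⟦ f ∈? S ⟧ (colCoeff pos τ) (rowSum τ (eg f))))
             (ΣL-* (allFin n) (colCoeff pos τ) (λ f → ⟦ f ∈? S ⟧ * rowSum τ (eg f)))) ⟩
      ΣP (λ τ → colCoeff pos τ * ΣF (λ f → ⟦ f ∈? S ⟧ * rowSum τ (eg f))) ∎
    where
    open ≡-Reasoning
    eg : Fin n → Perm n
    eg f = transposition e f ∘ g
    exchange : ∀ (a b c : ℤ) → a * (b * c) ≡ b * (a * c)
    exchange = solve-∀

  -- The theorem, coefficientwise: c_T - Σ_{f∈S} (e f) c_T has coefficients
  -- Σ_τ [τ ∈ C_T] defect(τ), which vanishes because τ ↦ u τ preserves C_T
  -- and reverses the sign of the defect.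
  youngCoeff-expansion : ∀ (g : Perm n) →
    youngCoeff pos g ≡ ΣF (λ f → ⟦ f ∈? S ⟧ * youngCoeff pos (transposition e f ∘ g))
  youngCoeff-expansion g = i-j≡0⇒i≡j _ _ (begin
      youngCoeff pos g - ΣF (λ f → ⟦ f ∈? S ⟧ * youngCoeff pos (transposition e f ∘ g))
        ≡⟨ cong₂ _-_ (youngCoeff-rowSum g) (ΣS-youngCoeff g) ⟩
      ΣP (λ τ → colCoeff pos τ * rowSum τ g) - ΣP (λ τ → colCoeff pos τ * ΣS τ)
        ≡⟨ cong (ΣP (λ τ → colCoeff pos τ * rowSum τ g) +_) (sym (ΣL-neg (allFuns n) (λ τ → colCoeff pos τ * ΣS τ))) ⟩
      ΣP (λ τ → colCoeff pos τ * rowSum τ g) + ΣP (λ τ → - (colCoeff pos τ * ΣS τ))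
        ≡⟨ sym (ΣL-+ (allFuns n) (λ τ → colCoeff pos τ * rowSum τ g) (λ τ → - (colCoeff pos τ * ΣS τ))) ⟩
      ΣP (λ τ → colCoeff pos τ * rowSum τ g + - (colCoeff pos τ * ΣS τ))
        ≡⟨ ΣP-cong (λ τ → factor (colCoeff pos τ) (rowSum τ g) (ΣS τ)) ⟩
      ΣP (λ τ → colCoeff pos τ * defect g τ)
        ≡⟨ antisymmetric-sum (u ∘_) (λ q i → cong u (q i)) (λ τ i → transposition-involutive e s₀ (τ i))
             (λ τ → colCoeff pos τ * defect g τ) (λ q → cong₂ _*_ (colCoeff-cong pos q) (defect-cong g q))
             (λ τ → trans (cong₂ _*_ (colCoeff-u∘ τ) (Antisymmetry.defect-u∘ τ g)) (sym (neg-distribʳ-* (colCoeff pos τ) (defect g τ)))) ⟩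
      0ℤ ∎)
    where
    open ≡-Reasoning
    open Reindexing (map-enumeration n) using (antisymmetric-sum)
    ΣS : Perm n → ℤ
    ΣS τ = ΣF (λ f → ⟦ f ∈? S ⟧ * rowSum τ (transposition e f ∘ g))
    factor : ∀ (k x y : ℤ) → k * x + - (k * y) ≡ k * (x - y)
    factor = solve-∀

single-column-col : ∀ m r c → InShape (replicate m 1) (r , c) → c ≡ 0
single-column-col (suc m) zero zero _ = refl
single-column-col (suc m) zero (suc c) (ℕ.s≤s ())
single-column-col (suc m) (suc r) c h = single-column-col m r c h

single-column-row : ∀ m r c → InShape (replicate m 1) (r , c) → r ℕ.< m
single-column-row (suc m) zero c _ = ℕ.s≤s ℕ.z≤n
single-column-row (suc m) (suc r) c h = ℕ.s≤s (single-column-row m r c h)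

sum-replicate-1 : ∀ m → sum (replicate m 1) ≡ m
sum-replicate-1 zero = refl
sum-replicate-1 (suc m) = cong suc (sum-replicate-1 m)

hook-column-0 : ∀ k m (p : ℕ × ℕ) → InShape (k ∷ replicate m 1) p → proj₁ p ≢ 0 → proj₂ p ≡ 0
hook-column-0 k m (zero , c) h ne = ⊥-elim (ne refl)
hook-column-0 k m (suc r , c) h ne = single-column-col m r c h

first-row-nonempty : ∀ k m (p : ℕ × ℕ) → InShape (k ∷ replicate m 1) p → proj₁ p ≡ 0 → 0 ℕ.< k
first-row-nonempty k m (zero , c) c<k _ = ℕP.≤-<-trans ℕ.z≤n c<k

cellIndex : ℕ → ℕ × ℕ → ℕ
cellIndex k (zero , c) = c
cellIndex k (suc r , c) = k ℕ.+ r

cellIndex-bound : ∀ k m (p : ℕ × ℕ) → InShape (k ∷ replicate m 1) p → cellIndex k p ℕ.< k ℕ.+ m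
cellIndex-bound k m (zero , c) h = ℕP.<-≤-trans h (ℕP.m≤m+n k m)
cellIndex-bound k m (suc r , c) h = ℕP.+-monoʳ-< k (single-column-row m r c h)

cellIndex-injective : ∀ k m (p q : ℕ × ℕ) → InShape (k ∷ replicate m 1) p → InShape (k ∷ replicate m 1) q →
  cellIndex k p ≡ cellIndex k q → p ≡ q
cellIndex-injective k m (zero , c) (zero , c') hp hq eq = cong (0 ,_) eq
cellIndex-injective k m (zero , c) (suc r' , c') hp hq eq = ⊥-elim (ℕP.<-irrefl eq (ℕP.<-≤-trans hp (ℕP.m≤m+n k r')))
cellIndex-injective k m (suc r , c) (zero , c') hp hq eq = ⊥-elim (ℕP.<-irrefl (sym eq) (ℕP.<-≤-trans hq (ℕP.m≤m+n k r)))
cellIndex-injective k m (suc r , c) (suc r' , c') hp hq eq =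
  cong₂ _,_ (cong suc (ℕP.+-cancelˡ-≡ k r r' eq)) (trans (single-column-col m r c hp) (sym (single-column-col m r' c' hq)))

-- A filling of a nonempty hook (k, 1^{n-k}) by 1, …, n occupies every cell;
-- in particular some entry sits in the corner (0, 0).  (The cell index of a
-- filling is an injective, hence surjective, endomap of Fin n.)
hook-corner : ∀ {n} k (pos : Fin n → ℕ × ℕ) → IsTableau (hook n k) pos →
  (x : Fin n) → proj₁ (pos x) ≡ 0 → Σ (Fin n) (λ s₀ → pos s₀ ≡ (0 , 0))
hook-corner {suc n'} k pos (size , pos-injective , in-shape) x x-row = s₀ , corner (pos s₀) index-s₀
  where
  m : ℕ
  m = suc n' ℕ.∸ k
  cells : k ℕ.+ m ≡ suc n'
  cells = trans (cong (k ℕ.+_) (sym (sum-replicate-1 m))) size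
  index : Fin (suc n') → Fin (suc n')
  index i = F.fromℕ< (subst (cellIndex k (pos i) ℕ.<_) cells (cellIndex-bound k m (pos i) (in-shape i)))
  index-injective : ∀ i j → index i ≡ index j → i ≡ j
  index-injective i j eq = pos-injective i j (cellIndex-injective k m (pos i) (pos j) (in-shape i) (in-shape j)
    (trans (sym (FP.toℕ-fromℕ< _)) (trans (cong toℕ eq) (FP.toℕ-fromℕ< _))))
  preimage : Σ (Fin (suc n')) (λ a → index a ≡ F.zero)
  preimage = injective⇒surjective index index-injective F.zero
  s₀ : Fin (suc n')
  s₀ = proj₁ preimage
  index-s₀ : cellIndex k (pos s₀) ≡ 0
  index-s₀ = trans (sym (FP.toℕ-fromℕ< _)) (cong toℕ (proj₂ preimage))
  k-positive : 0 ℕ.< k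
  k-positive = first-row-nonempty k m (pos x) (in-shape x) x-row
  corner : ∀ (p : ℕ × ℕ) → cellIndex k p ≡ 0 → p ≡ (0 , 0)
  corner (zero , c) eq = cong (0 ,_) eq
  corner (suc r , c) eq = ⊥-elim (ℕP.<-irrefl (sym (ℕP.m+n≡0⇒m≡0 k eq)) k-positive)

coeff-sumOver : ∀ {n} (S : Subset n) (F : Fin n → GA n) g → coeff (sumOver S F) g ≡ ΣF (λ f → ⟦ f ∈? S ⟧ * coeff (F f) g)
coeff-sumOver {n} S F g = trans (coeff-concatMap F (filter (_∈? S) (allFin n)) g) (ΣL-filter (_∈? S) (allFin n) (λ f → coeff (F f) g))

coeff-swapped-term : ∀ {n} (pos : Pos n) (e f : Fin n) g →
  coeff (youngSym (swapEntries pos e f) ⊛ basis (transposition e f)) g ≡ youngCoeff pos (transposition e f ∘ g)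
coeff-swapped-term {n} pos e f g = begin
    coeff (youngSym (swapEntries pos e f) ⊛ basis t) g
      ≡⟨ coeff-⊛-involution (youngSym (swapEntries pos e f)) t (transposition-involutive e f) g ⟩
    coeff (youngSym (pos ∘ t)) (g ∘ t)
      ≡⟨ coeff-youngSym (pos ∘ t) (g ∘ t) ⟩
    youngCoeff (pos ∘ t) (g ∘ t)
      ≡⟨ Conjugation.youngCoeff-conj t (transposition-involutive e f) pos (g ∘ t) ⟩
    youngCoeff pos (t ∘ g ∘ t ∘ t)
      ≡⟨ youngCoeff-cong pos (λ i → cong (t ∘ g) (transposition-involutive e f i)) ⟩
    youngCoeff pos (t ∘ g) ∎
  where
  open ≡-Reasoning
  t : Perm n
  t = transposition e f

mainTheorem13 : (n : ℕ) (S : Subset n) → Nonempty S →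
  (pos : Fin n → ℕ × ℕ) → IsTableau (hook n ∣ S ∣) pos →
  (∀ i → (proj₁ (pos i) ≡ 0 → i ∈ S) × (i ∈ S → proj₁ (pos i) ≡ 0)) →
  (e : Fin n) → e ∉ S →
  youngSym pos ≈ sumOver S (λ f → youngSym (swapEntries pos e f) ⊛ basis (transposition e f))
mainTheorem13 n S (x , x∈S) pos tableau@(_ , pos-injective , in-shape) first-row e e∉S g = begin
    coeff (youngSym pos) g
      ≡⟨ coeff-youngSym pos g ⟩
    youngCoeff pos g
      ≡⟨ Cancellation.youngCoeff-expansion S pos pos-injective first-row e e∉S
           s₀ (proj₁ (first-row s₀) (cong proj₁ s₀-corner)) (cong proj₂ s₀-corner)
           (λ i → hook-column-0 ∣ S ∣ (n ℕ.∸ ∣ S ∣) (pos i) (in-shape i)) g ⟩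
    ΣF (λ f → ⟦ f ∈? S ⟧ * youngCoeff pos (transposition e f ∘ g))
      ≡⟨ ΣF-cong (λ f → cong (⟦ f ∈? S ⟧ *_) (sym (coeff-swapped-term pos e f g))) ⟩
    ΣF (λ f → ⟦ f ∈? S ⟧ * coeff (youngSym (swapEntries pos e f) ⊛ basis (transposition e f)) g)
      ≡⟨ sym (coeff-sumOver S (λ f → youngSym (swapEntries pos e f) ⊛ basis (transposition e f)) g) ⟩
    coeff (sumOver S (λ f → youngSym (swapEntries pos e f) ⊛ basis (transposition e f))) g ∎
  where
  open ≡-Reasoning
  corner : Σ (Fin n) (λ s₀ → pos s₀ ≡ (0 , 0))
  corner = hook-corner ∣ S ∣ pos tableau x (proj₂ (first-row x) x∈S)
  s₀ : Fin n
  s₀ = proj₁ corner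
  s₀-corner : pos s₀ ≡ (0 , 0)
  s₀-corner = proj₂ corner
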